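{- If $G$ is a cyclically $4$-edge-connected cubic bipartite graph with at least $8$ vertices, then every edge of $G$ is contained in at least $3$ perfect matchings of $G$.
   Context: Graphs may have parallel edges. An edge-cut (set of edges between the two parts of a vertex partition) is cyclic if both parts induce subgraphs containing a cycle; a graph is cyclically $4$-edge-connected if it has no cyclic edge-cut with fewer than $4$ edges. -}

module Defs where

open import Data.Nat using (ℕ; zero; suc; _+_; _≤_)
open import Data.Nat.DivMod using (_%_; m%n<n)
open import Data.Fin using (Fin; toℕ; fromℕ<)
open import Data.Fin.Properties using (_≟_)
open import Data.Fin.Subset using (Subset; _∈_; _∉_; ∁)
open import Data.Fin.Subset.Properties using (_∈?_)
open import Data.Bool using (Bool; true; false; if_then_else_; _xor_)
open import Data.List using (List; map; allFin)
open import Data.Nat.ListAction using (sum)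
open import Data.Product using (_×_; _,_; proj₁; proj₂; Σ; ∃)
open import Data.Sum using (_⊎_)
open import Function.Definitions using (Injective)
open import Relation.Nullary using (¬_)
open import Relation.Nullary.Decidable using (⌊_⌋)
open import Relation.Binary.PropositionalEquality using (_≡_; _≢_)

-- A finite multigraph: vertices Fin n, edges Fin m, each edge has two ends.
-- Parallel edges are allowed (ends need not be injective).
record Graph : Set where
  field
    n    : ℕ
    m    : ℕ
    ends : Fin m → Fin n × Fin n

open Graph public

Vertex : Graph → Set
Vertex G = Fin (n G)

Edge : Graph → Set
Edge G = Fin (m G)

Joins : (G : Graph) → Edge G → Vertex G → Vertex G → Set
Joins G e u v = ends G e ≡ (u , v) ⊎ ends G e ≡ (v , u)

Incident : (G : Graph) → Edge G → Vertex G → Set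
Incident G e v = proj₁ (ends G e) ≡ v ⊎ proj₂ (ends G e) ≡ v

indicator : Bool → ℕ
indicator b = if b then 1 else 0

-- degree of v: number of edge-ends at v (a loop would count twice)
degree : (G : Graph) → Vertex G → ℕ
degree G v = sum (map (λ e → indicator ⌊ proj₁ (ends G e) ≟ v ⌋
                           + indicator ⌊ proj₂ (ends G e) ≟ v ⌋)
                      (allFin (m G)))

Cubic : Graph → Set
Cubic G = (v : Vertex G) → degree G v ≡ 3

Bipartite : Graph → Set
Bipartite G = Σ (Vertex G → Bool) λ c →
  (e : Edge G) → c (proj₁ (ends G e)) ≢ c (proj₂ (ends G e))

next : {k : ℕ} → Fin (suc k) → Fin (suc k)
next {k} i = fromℕ< (m%n<n (suc (toℕ i)) (suc k))

-- A cycle of length suc k: distinct vertices vs 0..k and distinct edges es 0..k,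
-- with es i joining vs i and vs (i+1 mod (k+1)).  Length 1 = loop,
-- length 2 = pair of parallel edges.
record Cycle (G : Graph) (k : ℕ) : Set where
  field
    vs     : Fin (suc k) → Vertex G
    es     : Fin (suc k) → Edge G
    vs-inj : Injective _≡_ _≡_ vs
    es-inj : Injective _≡_ _≡_ es
    joins  : (i : Fin (suc k)) → Joins G (es i) (vs i) (vs (next i))

-- the subgraph induced by S contains a cycle
-- (all vertices of the cycle in S, hence all its edges are induced by S)
HasCycleIn : (G : Graph) → Subset (n G) → Set
HasCycleIn G S = Σ ℕ λ k → Σ (Cycle G k) λ C →
  (i : Fin (suc k)) → Cycle.vs C i ∈ S

cutSize : (G : Graph) → Subset (n G) → ℕ
cutSize G S = sum (map (λ e → indicator (⌊ proj₁ (ends G e) ∈? S ⌋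
                                          xor ⌊ proj₂ (ends G e) ∈? S ⌋))
                       (allFin (m G)))

Cyclically4EdgeConnected : Graph → Set
Cyclically4EdgeConnected G = (S : Subset (n G)) →
  HasCycleIn G S → HasCycleIn G (∁ S) → 4 ≤ cutSize G S

IsPerfectMatching : (G : Graph) → Subset (m G) → Set
IsPerfectMatching G M = (v : Vertex G) → Σ (Edge G) λ e →
  e ∈ M × Incident G e v × ((e' : Edge G) → e' ∈ M → Incident G e' v → e' ≡ e)

module Submission where

-- Let e = uv with u in colour class true.  As G is cubic,
-- u and v have at most six neighbours altogether, so (having at least 8
-- vertices) G has a vertex w that is neither adjacent to u nor to v.  For each
-- of the three edges f = xy at w (x in colour class true) we get u ≠ x and
-- v ≠ y, and we show that G − {u, v, x, y} has a perfect matching, which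
-- together with e and f is a perfect matching of G.  These three perfect
-- matchings contain different edges at w, so they are different.
--
-- The matching of G − {u, v, x, y} comes from Hall's theorem.  If a set X of
-- remaining true vertices had fewer remaining neighbours than |X|, counting
-- edge-ends in the cubic graph shows that S = X ∪ N(X) ∪ {v, y} is separated
-- from its complement (which contains u and x) by at most 3 edges.  A vertex
-- set with at least 2 vertices and at most 3 outgoing edges spans at least as
-- many edges as it has vertices, hence contains a cycle; so this cut would be
-- cyclic, contradicting cyclic 4-edge-connectivity.

open import Defs
open import Data.Nat using (ℕ; zero; suc; _+_; _*_; _∸_; _≤_; _<_; z≤n; s≤s; _≤?_)
open import Data.Nat.Properties hiding (_≟_)
open import Data.Nat.Tactic.RingSolver using (solve-∀)
open import Data.Nat.DivMod using (_%_; m<n⇒m%n≡m; n%n≡0)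
open import Data.Fin as F using (Fin; toℕ; fromℕ<)
import Data.Fin.Properties as FP
open import Data.Fin.Subset using (Subset; _∈_; ∁)
open import Data.Fin.Subset.Properties using (_∈?_; x∉p⇒x∈∁p)
open import Data.Bool using (Bool; true; false; _∧_; _∨_; _xor_; not; if_then_else_)
open import Data.Product using (Σ; ∃; _×_; _,_; proj₁; proj₂)
open import Data.Sum using (_⊎_; inj₁; inj₂)
open import Data.Empty using (⊥; ⊥-elim)
open import Data.List using (map; allFin)
import Data.List as List
open import Data.List.Properties using (map-tabulate)
open import Data.Nat.ListAction using (sum)
open import Data.Vec using (tabulate)
open import Data.Vec.Properties using (lookup∘tabulate; lookup⇒[]=; []=⇒lookup)
open import Relation.Nullary using (yes; no)
open import Relation.Nullary.Decidable using (⌊_⌋)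
open import Relation.Binary using (tri<; tri≈; tri>)
open import Relation.Binary.PropositionalEquality
  using (_≡_; _≢_; refl; sym; trans; cong; cong₂; subst; subst₂; module ≡-Reasoning)

Pred : ℕ → Set
Pred n = Fin n → Bool

t≢f : ∀ {a} → a ≡ true → a ≡ false → ⊥
t≢f refl ()

not-true : ∀ {b} → (b ≡ true → ⊥) → b ≡ false
not-true {false} h = refl
not-true {true} h = ⊥-elim (h refl)

∧-l : ∀ {a b} → a ∧ b ≡ true → a ≡ true
∧-l {true} h = refl

∧-r : ∀ {a b} → a ∧ b ≡ true → b ≡ true
∧-r {true} h = h

∧-i : ∀ {a b} → a ≡ true → b ≡ true → a ∧ b ≡ true
∧-i refl refl = refl

∧-false : ∀ {a b} → a ∧ b ≡ false → a ≡ true → b ≡ false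
∧-false {true} h refl = h

∨-l : ∀ {a b} → a ≡ true → a ∨ b ≡ true
∨-l refl = refl

∨-r : ∀ {a b} → b ≡ true → a ∨ b ≡ true
∨-r {false} h = h
∨-r {true} h = refl

∨-false-l : ∀ {a b} → a ∨ b ≡ false → a ≡ false
∨-false-l {false} h = refl

∨-false-r : ∀ {a b} → a ∨ b ≡ false → b ≡ false
∨-false-r {false} h = h

not-t : ∀ {a} → not a ≡ true → a ≡ false
not-t {false} h = refl

not-f : ∀ {a} → a ≡ false → not a ≡ true
not-f refl = refl

-- Boolean equality on Fin n, computing by recursion so that sums against it
-- reduce (see ∑-delta).

eqFin : ∀ {n} → Fin n → Fin n → Bool
eqFin F.zero F.zero = true
eqFin F.zero (F.suc b) = false
eqFin (F.suc a) F.zero = false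
eqFin (F.suc a) (F.suc b) = eqFin a b

eqFin⇒≡ : ∀ {n} (a b : Fin n) → eqFin a b ≡ true → a ≡ b
eqFin⇒≡ F.zero F.zero _ = refl
eqFin⇒≡ (F.suc a) (F.suc b) h = cong F.suc (eqFin⇒≡ a b h)

eqFin-refl : ∀ {n} (a : Fin n) → eqFin a a ≡ true
eqFin-refl F.zero = refl
eqFin-refl (F.suc a) = eqFin-refl a

eqFin-sym : ∀ {n} (a b : Fin n) → eqFin a b ≡ eqFin b a
eqFin-sym F.zero F.zero = refl
eqFin-sym F.zero (F.suc b) = refl
eqFin-sym (F.suc a) F.zero = refl
eqFin-sym (F.suc a) (F.suc b) = eqFin-sym a b

≢⇒eqFin-false : ∀ {n} (a b : Fin n) → a ≢ b → eqFin a b ≡ false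
≢⇒eqFin-false a b a≢b = not-true λ h → a≢b (eqFin⇒≡ a b h)

eqFin-false⇒≢ : ∀ {n} {a b : Fin n} → eqFin a b ≡ false → a ≢ b
eqFin-false⇒≢ {a = a} h refl = t≢f (eqFin-refl a) h

≟-eqFin : ∀ {n} (a b : Fin n) → ⌊ a FP.≟ b ⌋ ≡ eqFin a b
≟-eqFin a b with a FP.≟ b
... | yes refl = sym (eqFin-refl a)
... | no a≢b = sym (≢⇒eqFin-false a b a≢b)

∑ : ∀ {n} → (Fin n → ℕ) → ℕ
∑ {zero} f = 0
∑ {suc n} f = f F.zero + ∑ (λ i → f (F.suc i))

sum-allFin : ∀ {n} (f : Fin n → ℕ) → sum (map f (allFin n)) ≡ ∑ f
sum-allFin {zero} f = refl
sum-allFin {suc n} f = cong (f F.zero +_) (begin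
    sum (map f (List.tabulate F.suc))            ≡⟨ cong sum (map-tabulate F.suc f) ⟩
    sum (List.tabulate (λ i → f (F.suc i)))       ≡⟨ cong sum (sym (map-tabulate (λ i → i) (λ i → f (F.suc i)))) ⟩
    sum (map (λ i → f (F.suc i)) (allFin n))      ≡⟨ sum-allFin (λ i → f (F.suc i)) ⟩
    ∑ (λ i → f (F.suc i))                         ∎)
  where open ≡-Reasoning

∑-cong : ∀ {n} {f g : Fin n → ℕ} → (∀ i → f i ≡ g i) → ∑ f ≡ ∑ g
∑-cong {zero} h = refl
∑-cong {suc n} h = cong₂ _+_ (h F.zero) (∑-cong (λ i → h (F.suc i)))

∑-mono : ∀ {n} {f g : Fin n → ℕ} → (∀ i → f i ≤ g i) → ∑ f ≤ ∑ g
∑-mono {zero} h = z≤n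
∑-mono {suc n} h = +-mono-≤ (h F.zero) (∑-mono (λ i → h (F.suc i)))

∑-+ : ∀ {n} (f g : Fin n → ℕ) → ∑ (λ i → f i + g i) ≡ ∑ f + ∑ g
∑-+ {zero} f g = refl
∑-+ {suc n} f g = trans (cong (f F.zero + g F.zero +_) (∑-+ (λ i → f (F.suc i)) (λ i → g (F.suc i))))
                        (+-assoc-swap (f F.zero) (g F.zero) _ _)
  where
  +-assoc-swap : ∀ a b c d → a + b + (c + d) ≡ a + c + (b + d)
  +-assoc-swap = solve-∀

∑-zero : ∀ {n} → ∑ {n} (λ _ → 0) ≡ 0
∑-zero {zero} = refl
∑-zero {suc n} = ∑-zero {n}

∑-* : ∀ {n} (c : ℕ) (f : Fin n → ℕ) → ∑ (λ i → c * f i) ≡ c * ∑ f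
∑-* {zero} c f = sym (*-zeroʳ c)
∑-* {suc n} c f = trans (cong (c * f F.zero +_) (∑-* c (λ i → f (F.suc i))))
                        (sym (*-distribˡ-+ c (f F.zero) _))

∑-swap : ∀ {n k} (h : Fin n → Fin k → ℕ) → ∑ (λ i → ∑ (λ j → h i j)) ≡ ∑ (λ j → ∑ (λ i → h i j))
∑-swap {zero} {k} h = sym (∑-zero {k})
∑-swap {suc n} {k} h = trans (cong (∑ (h F.zero) +_) (∑-swap (λ i j → h (F.suc i) j)))
                             (sym (∑-+ (h F.zero) (λ j → ∑ (λ i → h (F.suc i) j))))

∑-delta : ∀ {n} (f : Fin n → ℕ) (p : Fin n) → ∑ (λ z → indicator (eqFin p z) * f z) ≡ f p
∑-delta {suc n} f F.zero = trans (cong (λ s → f F.zero + 0 + s) (∑-zero {n})) (trans (+-identityʳ _) (+-identityʳ _))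
∑-delta {suc n} f (F.suc p) = ∑-delta (λ i → f (F.suc i)) p

∑-pos : ∀ {n} (f : Fin n → ℕ) → 0 < ∑ f → ∃ λ i → 0 < f i
∑-pos {suc n} f h with f F.zero in eq
... | suc _ = F.zero , subst (0 <_) (sym eq) (s≤s z≤n)
... | zero with ∑-pos (λ i → f (F.suc i)) h
... | i , p = F.suc i , p

term≤∑ : ∀ {n} (f : Fin n → ℕ) (i : Fin n) → f i ≤ ∑ f
term≤∑ {suc n} f F.zero = m≤m+n _ _
term≤∑ {suc n} f (F.suc i) = ≤-trans (term≤∑ (λ j → f (F.suc j)) i) (m≤n+m _ _)

count : ∀ {n} → Pred n → ℕ
count p = ∑ (λ i → indicator (p i))

count-cong : ∀ {n} {p q : Pred n} → (∀ i → p i ≡ q i) → count p ≡ count q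
count-cong h = ∑-cong (λ i → cong indicator (h i))

indicator-mono : ∀ {b c} → (b ≡ true → c ≡ true) → indicator b ≤ indicator c
indicator-mono {false} h = z≤n
indicator-mono {true} h rewrite h refl = ≤-refl

count-mono : ∀ {n} {p q : Pred n} → (∀ i → p i ≡ true → q i ≡ true) → count p ≤ count q
count-mono h = ∑-mono (λ i → indicator-mono (h i))

count-zero : ∀ {n} (p : Pred n) → count p ≡ 0 → ∀ i → p i ≡ false
count-zero p h i = not-true λ pi → 1+n≰n (≤-trans (subst (λ b → indicator b ≤ count p) pi (term≤∑ _ i))
                                                   (≤-reflexive h))

count-pos : ∀ {n} (p : Pred n) → 0 < count p → ∃ λ i → p i ≡ true
count-pos p h with ∑-pos (λ i → indicator (p i)) h
... | i , q with p i in eq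
... | true = i , eq
... | false = ⊥-elim (1+n≰n q)

indicator-∧ : ∀ b c → indicator (b ∧ c) ≡ indicator c * indicator b
indicator-∧ false false = refl
indicator-∧ false true = refl
indicator-∧ true false = refl
indicator-∧ true true = refl

indicator-∨ : ∀ b c → indicator (b ∨ c) ≤ indicator b + indicator c
indicator-∨ false c = ≤-refl
indicator-∨ true false = ≤-refl
indicator-∨ true true = s≤s z≤n

indicator-∨-disjoint : ∀ b c → b ∧ c ≡ false → indicator (b ∨ c) ≡ indicator b + indicator c
indicator-∨-disjoint false c h = refl
indicator-∨-disjoint true false h = refl

indicator-split : ∀ b c → indicator b ≡ indicator (b ∧ c) + indicator (b ∧ not c)
indicator-split false c = refl
indicator-split true false = refl
indicator-split true true = refl

count-split : ∀ {n} (p q : Pred n) → count p ≡ count (λ i → p i ∧ q i) + count (λ i → p i ∧ not (q i))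
count-split p q = trans (∑-cong (λ i → indicator-split (p i) (q i)))
                        (∑-+ (λ i → indicator (p i ∧ q i)) (λ i → indicator (p i ∧ not (q i))))

count-∨ : ∀ {n} (p q : Pred n) → count (λ i → p i ∨ q i) ≤ count p + count q
count-∨ p q = ≤-trans (∑-mono (λ i → indicator-∨ (p i) (q i)))
                      (≤-reflexive (∑-+ (λ i → indicator (p i)) (λ i → indicator (q i))))

count-∨-disjoint : ∀ {n} (p q : Pred n) → (∀ i → p i ∧ q i ≡ false) → count (λ i → p i ∨ q i) ≡ count p + count q
count-∨-disjoint p q h = trans (∑-cong (λ i → indicator-∨-disjoint (p i) (q i) (h i)))
                               (∑-+ (λ i → indicator (p i)) (λ i → indicator (q i)))

count-all : ∀ {n} → count {n} (λ _ → true) ≡ n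
count-all {zero} = refl
count-all {suc n} = cong suc (count-all {n})

count-single : ∀ {n} (a : Fin n) → count (eqFin a) ≡ 1
count-single a = trans (∑-cong (λ i → sym (*-identityʳ (indicator (eqFin a i))))) (∑-delta (λ _ → 1) a)

count-at : ∀ {n} (p : Pred n) (a : Fin n) → count (λ i → p i ∧ eqFin a i) ≡ indicator (p a)
count-at p a = trans (∑-cong (λ i → indicator-∧ (p i) (eqFin a i))) (∑-delta (λ i → indicator (p i)) a)

count-remove : ∀ {n} (p : Pred n) (a : Fin n) → p a ≡ true →
  count p ≡ suc (count (λ i → p i ∧ not (eqFin a i)))
count-remove p a pa = trans (count-split p (eqFin a))
  (cong (_+ count (λ i → p i ∧ not (eqFin a i))) (trans (count-at p a) (cong indicator pa)))

count-remove≤ : ∀ {n} (p : Pred n) (a : Fin n) → count p ≤ suc (count (λ i → p i ∧ not (eqFin a i)))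
count-remove≤ p a = ≤-trans (≤-reflexive (count-split p (eqFin a)))
  (+-monoˡ-≤ _ (≤-trans (≤-reflexive (count-at p a)) (indicator≤1 (p a))))
  where
  indicator≤1 : ∀ b → indicator b ≤ 1
  indicator≤1 false = z≤n
  indicator≤1 true = ≤-refl

count-pair≤ : ∀ {n} (a b : Fin n) → count (λ z → eqFin a z ∨ eqFin b z) ≤ 2
count-pair≤ a b = ≤-trans (count-∨ (eqFin a) (eqFin b)) (≤-reflexive (cong₂ _+_ (count-single a) (count-single b)))

count-pair : ∀ {n} (a b : Fin n) → a ≢ b → count (λ z → eqFin a z ∨ eqFin b z) ≡ 2
count-pair a b a≢b = trans (count-∨-disjoint (eqFin a) (eqFin b) disjoint) (cong₂ _+_ (count-single a) (count-single b))
  where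
  disjoint : ∀ z → eqFin a z ∧ eqFin b z ≡ false
  disjoint z = not-true λ h → a≢b (trans (eqFin⇒≡ _ _ (∧-l h)) (sym (eqFin⇒≡ _ _ (∧-r {eqFin a z} h))))

count≥2 : ∀ {n} (P : Pred n) a b → a ≢ b → P a ≡ true → P b ≡ true → 2 ≤ count P
count≥2 P a b a≢b pa pb = ≤-trans (≤-reflexive (sym (count-pair a b a≢b))) (count-mono mono)
  where
  mono : ∀ z → eqFin a z ∨ eqFin b z ≡ true → P z ≡ true
  mono z h with eqFin a z in ea
  ... | true = subst (λ w → P w ≡ true) (eqFin⇒≡ _ _ ea) pa
  ... | false = subst (λ w → P w ≡ true) (eqFin⇒≡ _ _ h) pb

three-witnesses : ∀ {k} (p : Pred k) → 3 ≤ count p →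
  Σ (Fin k) λ a → Σ (Fin k) λ b → Σ (Fin k) λ c →
    (p a ≡ true × p b ≡ true × p c ≡ true) × (a ≢ b × a ≢ c × b ≢ c)
three-witnesses p p≥3 =
  a , b , c , (pa , ∧-l pb , ∧-l (∧-l pc)) ,
  (≢-of (∧-r {p b} pb) , ≢-of (∧-r {p c} (∧-l pc)) , ≢-of (∧-r {p c ∧ not (eqFin a c)} pc))
  where
  ≢-of : ∀ {a' b'} → not (eqFin a' b') ≡ true → a' ≢ b'
  ≢-of h = eqFin-false⇒≢ (not-t h)
  a = proj₁ (count-pos p (≤-trans (s≤s z≤n) p≥3))
  pa = proj₂ (count-pos p (≤-trans (s≤s z≤n) p≥3))
  p₁ : Pred _
  p₁ i = p i ∧ not (eqFin a i)
  p₁≥2 : 2 ≤ count p₁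
  p₁≥2 = ≤-pred (≤-trans p≥3 (count-remove≤ p a))
  b = proj₁ (count-pos p₁ (≤-trans (s≤s z≤n) p₁≥2))
  pb = proj₂ (count-pos p₁ (≤-trans (s≤s z≤n) p₁≥2))
  p₂ : Pred _
  p₂ i = p₁ i ∧ not (eqFin b i)
  c = proj₁ (count-pos p₂ (≤-pred (≤-trans p₁≥2 (count-remove≤ p₁ b))))
  pc = proj₂ (count-pos p₂ (≤-pred (≤-trans p₁≥2 (count-remove≤ p₁ b))))

count-injection : ∀ {n} (p q : Pred n) (g : Fin n → Fin n) →
  (∀ a → p a ≡ true → q (g a) ≡ true) → (∀ a a' → p a ≡ true → p a' ≡ true → g a ≡ g a' → a ≡ a') →
  count p ≤ count q
count-injection p q g into inj = go (count p) p q ≤-refl into inj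
  where
  go : ∀ fuel (p q : Pred _) → count p ≤ fuel →
       (∀ a → p a ≡ true → q (g a) ≡ true) → (∀ a a' → p a ≡ true → p a' ≡ true → g a ≡ g a' → a ≡ a') →
       count p ≤ count q
  go fuel p q c into inj with 1 ≤? count p
  ... | no p-empty = ≤-trans (≤-pred (≰⇒> p-empty)) z≤n
  go zero p q c into inj | yes p-inhabited = ⊥-elim (1+n≰n (≤-trans p-inhabited c))
  go (suc fuel) p q c into inj | yes p-inhabited = begin
      count p          ≡⟨ count-remove p a pa ⟩
      suc (count p')   ≤⟨ s≤s (go fuel p' q' (≤-pred (subst (_≤ suc fuel) (count-remove p a pa) c)) into' inj') ⟩
      suc (count q')   ≡⟨ sym (count-remove q (g a) (into a pa)) ⟩
      count q          ∎
    where
    open ≤-Reasoning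
    a = proj₁ (count-pos p p-inhabited)
    pa = proj₂ (count-pos p p-inhabited)
    p' q' : Pred _
    p' z = p z ∧ not (eqFin a z)
    q' z = q z ∧ not (eqFin (g a) z)
    into' : ∀ a' → p' a' ≡ true → q' (g a') ≡ true
    into' a' h = ∧-i (into a' (∧-l h))
      (not-f (not-true λ e → eqFin-false⇒≢ (not-t (∧-r {p a'} h)) (inj a a' pa (∧-l h) (eqFin⇒≡ _ _ e))))
    inj' : ∀ a₁ a₂ → p' a₁ ≡ true → p' a₂ ≡ true → g a₁ ≡ g a₂ → a₁ ≡ a₂
    inj' a₁ a₂ h₁ h₂ = inj a₁ a₂ (∧-l h₁) (∧-l h₂)

anyF : ∀ {n} → Pred n → Bool
anyF {zero} p = false
anyF {suc n} p = p F.zero ∨ anyF (λ i → p (F.suc i))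

anyF-intro : ∀ {n} (p : Pred n) (i : Fin n) → p i ≡ true → anyF p ≡ true
anyF-intro p F.zero h rewrite h = refl
anyF-intro p (F.suc i) h = ∨-r {p F.zero} (anyF-intro (λ j → p (F.suc j)) i h)

anyF-elim : ∀ {n} (p : Pred n) → anyF p ≡ true → ∃ λ i → p i ≡ true
anyF-elim {suc n} p h with p F.zero in eq
... | true = F.zero , eq
... | false with anyF-elim (λ j → p (F.suc j)) h
... | i , q = F.suc i , q

anyF-cong : ∀ {n} {p q : Pred n} → (∀ i → p i ≡ q i) → anyF p ≡ anyF q
anyF-cong {zero} h = refl
anyF-cong {suc n} h = cong₂ _∨_ (h F.zero) (anyF-cong (λ i → h (F.suc i)))

anyF-false : ∀ {n} (p : Pred n) → (∀ i → p i ≡ false) → anyF p ≡ false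
anyF-false p h = not-true λ e → let (i , pi) = anyF-elim p e in t≢f pi (h i)

anyF-false⁻ : ∀ {n} (p : Pred n) → anyF p ≡ false → ∀ i → p i ≡ false
anyF-false⁻ p h i = not-true λ pi → t≢f (anyF-intro p i pi) h

indicator-anyF : ∀ {k} (p : Pred k) → indicator (anyF p) ≤ count p
indicator-anyF p with anyF p in h
... | false = z≤n
... | true = let (i , pi) = anyF-elim p h in
  ≤-trans (≤-reflexive (cong indicator (sym pi))) (term≤∑ (λ j → indicator (p j)) i)

chooseBy : ∀ {n} → Fin n → (p : Pred n) → (b : Bool) → anyF p ≡ b → Fin n
chooseBy d p true found = proj₁ (anyF-elim p found)
chooseBy d p false _ = d

choose : ∀ {n} → Fin n → Pred n → Fin n
choose d p = chooseBy d p (anyF p) refl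

choose-spec : ∀ {n} (d : Fin n) (p : Pred n) → anyF p ≡ true → p (choose d p) ≡ true
choose-spec d p = spec (anyF p) refl
  where
  spec : (b : Bool) (found : anyF p ≡ b) → b ≡ true → p (chooseBy d p b found) ≡ true
  spec true found _ = proj₂ (anyF-elim p found)

leb : ℕ → ℕ → Bool
leb zero n = true
leb (suc m) zero = false
leb (suc m) (suc n) = leb m n

leb⇒≤ : ∀ m n → leb m n ≡ true → m ≤ n
leb⇒≤ zero n h = z≤n
leb⇒≤ (suc m) (suc n) h = s≤s (leb⇒≤ m n h)

≤⇒leb : ∀ {m n} → m ≤ n → leb m n ≡ true
≤⇒leb z≤n = refl
≤⇒leb (s≤s p) = ≤⇒leb p

leb-false⇒> : ∀ m n → leb m n ≡ false → n < m
leb-false⇒> (suc m) zero h = s≤s z≤n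
leb-false⇒> (suc m) (suc n) h = s≤s (leb-false⇒> m n h)

_⊆_ : ∀ {n} → Pred n → Pred n → Set
X ⊆ L = ∀ i → X i ≡ true → L i ≡ true

sub : ∀ {n} → Pred n → Pred n → Bool
sub X L = not (anyF (λ i → X i ∧ not (L i)))

sub⇒⊆ : ∀ {n} (X L : Pred n) → sub X L ≡ true → X ⊆ L
sub⇒⊆ X L h i xi = not-f⁻ (∧-false (anyF-false⁻ _ (not-t h) i) xi)
  where
  not-f⁻ : ∀ {a} → not a ≡ false → a ≡ true
  not-f⁻ {true} _ = refl

⊆⇒sub : ∀ {n} (X L : Pred n) → X ⊆ L → sub X L ≡ true
⊆⇒sub X L h = not-f (anyF-false _ λ i → not-true λ e → t≢f (h i (∧-l e)) (not-t (∧-r {X i} e)))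

sub-cong : ∀ {n} {X Y : Pred n} (L : Pred n) → (∀ i → X i ≡ Y i) → sub X L ≡ sub Y L
sub-cong L h = cong not (anyF-cong (λ i → cong (_∧ not (L i)) (h i)))

cons : ∀ {n} → Bool → Pred n → Pred (suc n)
cons b p F.zero = b
cons b p (F.suc i) = p i

searchPred : ∀ {n} (Q : Pred n → Bool) → (∀ p q → (∀ i → p i ≡ q i) → Q p ≡ Q q) →
             (Σ (Pred n) λ p → Q p ≡ true) ⊎ (∀ p → Q p ≡ false)
searchPred {zero} Q ext with Q (λ ()) in eq
... | true = inj₁ ((λ ()) , eq)
... | false = inj₂ (λ p → trans (ext p (λ ()) (λ ())) eq)
searchPred {suc n} Q ext
  with searchPred (λ p → Q (cons false p)) (λ p q h → ext _ _ (cons-cong false h))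
     | searchPred (λ p → Q (cons true p)) (λ p q h → ext _ _ (cons-cong true h))
  where
  cons-cong : ∀ b {p q : Pred n} → (∀ i → p i ≡ q i) → ∀ i → cons b p i ≡ cons b q i
  cons-cong b h F.zero = refl
  cons-cong b h (F.suc i) = h i
... | inj₁ (p , h) | _ = inj₁ (cons false p , h)
... | inj₂ _ | inj₁ (p , h) = inj₁ (cons true p , h)
... | inj₂ none₀ | inj₂ none₁ = inj₂ λ p → by-head p (p F.zero) refl
  where
  η : ∀ (p : Pred (suc n)) b → p F.zero ≡ b → ∀ i → p i ≡ cons b (λ j → p (F.suc j)) i
  η p b e F.zero = e
  η p b e (F.suc i) = refl
  by-head : ∀ p b → p F.zero ≡ b → Q p ≡ false
  by-head p false e = trans (ext p _ (η p false e)) (none₀ _)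
  by-head p true e = trans (ext p _ (η p true e)) (none₁ _)

toSubset : ∀ {n} → Pred n → Subset n
toSubset P = tabulate P

toSubset-∈ : ∀ {n} (P : Pred n) x → P x ≡ true → x ∈ toSubset P
toSubset-∈ P x h = lookup⇒[]= x (toSubset P) (trans (lookup∘tabulate P x) h)

toSubset-∈⁻ : ∀ {n} (P : Pred n) x → x ∈ toSubset P → P x ≡ true
toSubset-∈⁻ P x h = trans (sym (lookup∘tabulate P x)) ([]=⇒lookup h)

toSubset-∉ : ∀ {n} (P : Pred n) x → P x ≡ false → x ∈ ∁ (toSubset P)
toSubset-∉ P x h = x∉p⇒x∈∁p (λ xi → t≢f (toSubset-∈⁻ P x xi) h)

∈?-toSubset : ∀ {n} (P : Pred n) x → ⌊ x ∈? toSubset P ⌋ ≡ P x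
∈?-toSubset P x with x ∈? toSubset P | P x in eq
... | yes h | true = refl
... | yes h | false = ⊥-elim (t≢f (toSubset-∈⁻ P x h) eq)
... | no h | true = ⊥-elim (h (toSubset-∈ P x eq))
... | no h | false = refl

-- The proof is the classical induction on |L|: if some nonempty proper
-- subset X of L is tight (|N(X)| = |X|), match X into N(X) and L ∖ X into
-- R ∖ N(X) separately; otherwise match any vertex to any neighbour and
-- recurse, the Hall condition surviving because every X has a surplus.

module Hall {n : ℕ} (adj : Fin n → Fin n → Bool) where

  Nb : Pred n → Pred n → Pred n
  Nb R X b = R b ∧ anyF (λ a → X a ∧ adj a b)

  HallCond : Pred n → Pred n → Set
  HallCond L R = ∀ X → X ⊆ L → count X ≤ count (Nb R X)

  record Matching (L R : Pred n) : Set where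
    field
      mate     : Fin n → Fin n
      mate-in  : ∀ a → L a ≡ true → R (mate a) ≡ true
      mate-adj : ∀ a → L a ≡ true → adj a (mate a) ≡ true
      mate-inj : ∀ a a' → L a ≡ true → L a' ≡ true → mate a ≡ mate a' → a ≡ a'

  Nb-cong : ∀ R {X Y : Pred n} → (∀ i → X i ≡ Y i) → ∀ b → Nb R X b ≡ Nb R Y b
  Nb-cong R h b = cong (R b ∧_) (anyF-cong (λ a → cong (_∧ adj a b) (h a)))

  Nb-sub : ∀ R X Z → Z ⊆ X → Nb R Z ⊆ Nb (Nb R X) Z
  Nb-sub R X Z Z⊆X b h with anyF-elim (λ a → Z a ∧ adj a b) (∧-r {R b} h)
  ... | a , za = ∧-i {R b ∧ anyF (λ a → X a ∧ adj a b)}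
                     (∧-i (∧-l {R b} h) (anyF-intro (λ a → X a ∧ adj a b) a (∧-i (Z⊆X a (∧-l {Z a} za)) (∧-r {Z a} za))))
                     (∧-r {R b} h)

  tight : Pred n → Pred n → Pred n → Bool
  tight L R X = sub X L ∧ (leb 1 (count X) ∧ (leb (suc (count X)) (count L) ∧ leb (count (Nb R X)) (count X)))

  tight-cong : ∀ L R X Y → (∀ i → X i ≡ Y i) → tight L R X ≡ tight L R Y
  tight-cong L R X Y h rewrite sub-cong L h | count-cong h | count-cong (Nb-cong R h) = refl

  record Tight (L R X : Pred n) : Set where
    field
      inside    : X ⊆ L
      nonempty  : 1 ≤ count X
      proper    : suc (count X) ≤ count L
      no-excess : count (Nb R X) ≤ count X

  tight⇒Tight : ∀ L R X → tight L R X ≡ true → Tight L R X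
  tight⇒Tight L R X t = record
    { inside = sub⇒⊆ X L (∧-l t)
    ; nonempty = leb⇒≤ 1 _ (∧-l t₁)
    ; proper = leb⇒≤ (suc (count X)) _ (∧-l t₂)
    ; no-excess = leb⇒≤ _ _ (∧-r {leb (suc (count X)) (count L)} t₂) }
    where
    t₁ = ∧-r {sub X L} t
    t₂ = ∧-r {leb 1 (count X)} t₁

  surplus : ∀ L R X → tight L R X ≡ false → X ⊆ L → 1 ≤ count X → suc (count X) ≤ count L →
            count X < count (Nb R X)
  surplus L R X nt X⊆L one prop = leb-false⇒> _ _ (peel (⊆⇒sub X L X⊆L) (≤⇒leb one) (≤⇒leb prop) nt)
    where
    peel : ∀ {a b c d} → a ≡ true → b ≡ true → c ≡ true → a ∧ (b ∧ (c ∧ d)) ≡ false → d ≡ false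
    peel refl refl refl h = h

  emptyMatching : ∀ L R → count L ≡ 0 → Matching L R
  emptyMatching L R c = record
    { mate = λ a → a
    ; mate-in = λ a la → ⊥-elim (t≢f la (count-zero L c a))
    ; mate-adj = λ a la → ⊥-elim (t≢f la (count-zero L c a))
    ; mate-inj = λ a _ la _ _ → ⊥-elim (t≢f la (count-zero L c a)) }

  edgeMatching : ∀ a₀ b₀ → adj a₀ b₀ ≡ true → Matching (eqFin a₀) (eqFin b₀)
  edgeMatching a₀ b₀ ab = record
    { mate = λ _ → b₀
    ; mate-in = λ _ _ → eqFin-refl b₀
    ; mate-adj = λ a h → subst (λ z → adj z b₀ ≡ true) (eqFin⇒≡ a₀ a h) ab
    ; mate-inj = λ a a' h h' _ → trans (sym (eqFin⇒≡ a₀ a h)) (eqFin⇒≡ a₀ a' h') }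

  glue : (L R X L₁ R₁ L₂ R₂ : Pred n) →
    (∀ a → L a ≡ true → X a ≡ true → L₁ a ≡ true) →
    (∀ a → L a ≡ true → X a ≡ false → L₂ a ≡ true) →
    R₁ ⊆ R → R₂ ⊆ R → (∀ b → R₁ b ≡ true → R₂ b ≡ false) →
    Matching L₁ R₁ → Matching L₂ R₂ → Matching L R
  glue L R X L₁ R₁ L₂ R₂ toL₁ toL₂ R₁⊆R R₂⊆R disjoint M₁ M₂ = record
    { mate = mate ; mate-in = mate-in ; mate-adj = mate-adj ; mate-inj = mate-inj }
    where
    module M₁ = Matching M₁
    module M₂ = Matching M₂
    mate : Fin n → Fin n
    mate a = if X a then M₁.mate a else M₂.mate a
    mate-in : ∀ a → L a ≡ true → R (mate a) ≡ true
    mate-in a la with X a in xa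
    ... | true = R₁⊆R _ (M₁.mate-in a (toL₁ a la xa))
    ... | false = R₂⊆R _ (M₂.mate-in a (toL₂ a la xa))
    mate-adj : ∀ a → L a ≡ true → adj a (mate a) ≡ true
    mate-adj a la with X a in xa
    ... | true = M₁.mate-adj a (toL₁ a la xa)
    ... | false = M₂.mate-adj a (toL₂ a la xa)
    across : ∀ a a' → L a ≡ true → L a' ≡ true → X a ≡ true → X a' ≡ false → M₁.mate a ≢ M₂.mate a'
    across a a' la la' xa xa' e =
      t≢f (subst (λ b → R₂ b ≡ true) (sym e) (M₂.mate-in a' (toL₂ a' la' xa')))
          (disjoint _ (M₁.mate-in a (toL₁ a la xa)))
    mate-inj : ∀ a a' → L a ≡ true → L a' ≡ true → mate a ≡ mate a' → a ≡ a'
    mate-inj a a' la la' e with X a in xa | X a' in xa'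
    ... | true | true = M₁.mate-inj a a' (toL₁ a la xa) (toL₁ a' la' xa') e
    ... | false | false = M₂.mate-inj a a' (toL₂ a la xa) (toL₂ a' la' xa') e
    ... | true | false = ⊥-elim (across a a' la la' xa xa' e)
    ... | false | true = ⊥-elim (across a' a la' la xa' xa (sym e))

  -- If X ⊆ L has no excess neighbours, the Hall condition passes to
  -- L ∖ X and R ∖ N(X): for Z ⊆ L ∖ X, |Z| + |X| ≤ |N(Z ∪ X)| ≤ |N_{R∖N(X)}(Z)| + |X|.
  hall-outside : ∀ L R X → HallCond L R → X ⊆ L → count (Nb R X) ≤ count X →
    HallCond (λ a → L a ∧ not (X a)) (λ b → R b ∧ not (Nb R X b))
  hall-outside L R X cond X⊆L no-excess Z Z⊆L∖X = +-cancelʳ-≤ (count X) _ _ (begin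
      count Z + count X                          ≡⟨ sym (count-∨-disjoint Z X disjoint) ⟩
      count W                                    ≤⟨ cond W W⊆L ⟩
      count (Nb R W)                             ≤⟨ count-mono split ⟩
      count (λ b → Nb R X b ∨ Nb R' Z b)         ≤⟨ count-∨ (Nb R X) (Nb R' Z) ⟩
      count (Nb R X) + count (Nb R' Z)           ≤⟨ +-monoˡ-≤ _ no-excess ⟩
      count X + count (Nb R' Z)                  ≡⟨ +-comm (count X) _ ⟩
      count (Nb R' Z) + count X                  ∎)
    where
    open ≤-Reasoning
    R' W : Pred n
    R' b = R b ∧ not (Nb R X b)
    W a = Z a ∨ X a
    disjoint : ∀ i → Z i ∧ X i ≡ false
    disjoint i = not-true λ h → t≢f (∧-r {Z i} h) (not-t (∧-r {L i} (Z⊆L∖X i (∧-l h))))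
    W⊆L : W ⊆ L
    W⊆L i w with Z i in zi
    ... | true = ∧-l (Z⊆L∖X i zi)
    ... | false = X⊆L i w
    split : ∀ b → Nb R W b ≡ true → Nb R X b ∨ Nb R' Z b ≡ true
    split b hb with Nb R X b in nx
    ... | true = refl
    ... | false with anyF-elim _ (∧-r {R b} hb)
    ... | a , wa with Z a in za
    ... | true = ∧-i (∧-i (∧-l hb) refl) (anyF-intro _ a (∧-i za (∧-r wa)))
    ... | false = ⊥-elim (t≢f (∧-i (∧-l hb) (anyF-intro _ a (∧-i (∧-l {b = adj a b} wa) (∧-r wa)))) nx)

  hall-delete : ∀ L R a₀ b₀ → (∀ X → tight L R X ≡ false) → L a₀ ≡ true →
    HallCond (λ a → L a ∧ not (eqFin a₀ a)) (λ b → R b ∧ not (eqFin b₀ b))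
  hall-delete L R a₀ b₀ no-tight la₀ Z Z⊆L' with 1 ≤? count Z
  ... | no Z-empty = ≤-trans (≤-pred (≰⇒> Z-empty)) z≤n
  ... | yes Z-inhabited = ≤-pred (begin
      suc (count Z)                                 ≤⟨ surplus L R Z (no-tight Z) Z⊆L Z-inhabited Z-proper ⟩
      count (Nb R Z)                                ≤⟨ count-remove≤ (Nb R Z) b₀ ⟩
      suc (count (λ b → Nb R Z b ∧ not (eqFin b₀ b))) ≤⟨ s≤s (count-mono into) ⟩
      suc (count (Nb R' Z))                         ∎)
    where
    open ≤-Reasoning
    R' : Pred n
    R' b = R b ∧ not (eqFin b₀ b)
    Z⊆L : Z ⊆ L
    Z⊆L i zi = ∧-l (Z⊆L' i zi)
    Z-proper : suc (count Z) ≤ count L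
    Z-proper = subst (suc (count Z) ≤_) (sym (count-remove L a₀ la₀)) (s≤s (count-mono Z⊆L'))
    into : ∀ b → Nb R Z b ∧ not (eqFin b₀ b) ≡ true → Nb R' Z b ≡ true
    into b q = ∧-i (∧-i (∧-l {R b} (∧-l q)) (∧-r {Nb R Z b} q)) (∧-r {R b} (∧-l q))

  HallUpTo : ℕ → Set
  HallUpTo k = ∀ L R → count L ≤ k → HallCond L R → Matching L R

  hall-tight : ∀ {k} → HallUpTo k → ∀ L R X → count L ≤ suc k → HallCond L R → Tight L R X → Matching L R
  hall-tight {k} ih L R X c cond T =
    glue L R X X (Nb R X) L₂ R₂ (λ a _ xa → xa) (λ a la xa → ∧-i la (not-f xa))
         (λ b h → ∧-l h) (λ b h → ∧-l h) (λ b h → not-true λ r₂ → t≢f h (not-t (∧-r {R b} r₂)))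
         (ih X (Nb R X) (≤-pred (≤-trans proper c)) hall-X)
         (ih L₂ R₂ (≤-pred (≤-trans L₂<L c)) (hall-outside L R X cond inside no-excess))
    where
    open Tight T
    L₂ R₂ : Pred n
    L₂ a = L a ∧ not (X a)
    R₂ b = R b ∧ not (Nb R X b)
    hall-X : HallCond X (Nb R X)
    hall-X Z Z⊆X = ≤-trans (cond Z (λ i zi → inside i (Z⊆X i zi))) (count-mono (Nb-sub R X Z Z⊆X))
    L₂<L : suc (count L₂) ≤ count L
    L₂<L = begin
      suc (count L₂)                   ≤⟨ +-monoˡ-≤ (count L₂) nonempty ⟩
      count X + count L₂               ≤⟨ +-monoˡ-≤ (count L₂) (count-mono λ i xi → ∧-i (inside i xi) xi) ⟩
      count (λ i → L i ∧ X i) + count L₂ ≡⟨ sym (count-split L X) ⟩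
      count L                          ∎
      where open ≤-Reasoning

  hall-no-tight : ∀ {k} → HallUpTo k → ∀ L R → count L ≤ suc k → HallCond L R →
                  (∀ X → tight L R X ≡ false) → 1 ≤ count L → Matching L R
  hall-no-tight {k} ih L R c cond no-tight L-inhabited =
    glue L R (eqFin a₀) (eqFin a₀) (eqFin b₀) L' R' (λ a _ e → e) (λ a la e → ∧-i la (not-f e))
         (λ b e → subst (λ z → R z ≡ true) (eqFin⇒≡ b₀ b e) Rb₀) (λ b h → ∧-l h)
         (λ b e → not-true λ h → t≢f (subst (λ z → eqFin b₀ z ≡ true) (eqFin⇒≡ b₀ b e) (eqFin-refl b₀))
                                      (not-t (∧-r {R b} h)))
         (edgeMatching a₀ b₀ adj₀)
         (ih L' R' (≤-pred (subst (_≤ suc k) (count-remove L a₀ la₀) c)) (hall-delete L R a₀ b₀ no-tight la₀))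
    where
    a₀ = proj₁ (count-pos L L-inhabited)
    la₀ = proj₂ (count-pos L L-inhabited)
    N₀ : 1 ≤ count (Nb R (eqFin a₀))
    N₀ = ≤-trans (≤-reflexive (sym (count-single a₀)))
                 (cond (eqFin a₀) (λ i e → subst (λ j → L j ≡ true) (eqFin⇒≡ a₀ i e) la₀))
    b₀ = proj₁ (count-pos (Nb R (eqFin a₀)) N₀)
    Nb₀ = proj₂ (count-pos (Nb R (eqFin a₀)) N₀)
    Rb₀ : R b₀ ≡ true
    Rb₀ = ∧-l {R b₀} Nb₀
    adj₀ : adj a₀ b₀ ≡ true
    adj₀ with anyF-elim (λ a → eqFin a₀ a ∧ adj a b₀) (∧-r {R b₀} Nb₀)
    ... | a , q = subst (λ j → adj j b₀ ≡ true) (sym (eqFin⇒≡ a₀ a (∧-l {eqFin a₀ a} q))) (∧-r {eqFin a₀ a} q)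
    L' R' : Pred n
    L' a = L a ∧ not (eqFin a₀ a)
    R' b = R b ∧ not (eqFin b₀ b)

  hall-upto : ∀ k → HallUpTo k
  hall-upto zero L R c _ = emptyMatching L R (n≤0⇒n≡0 c)
  hall-upto (suc k) L R c cond with 1 ≤? count L
  ... | no L-empty = emptyMatching L R (n≤0⇒n≡0 (≤-pred (≰⇒> L-empty)))
  ... | yes L-inhabited with searchPred (tight L R) (tight-cong L R)
  ... | inj₁ (X , t) = hall-tight (hall-upto k) L R X c cond (tight⇒Tight L R X t)
  ... | inj₂ no-tight = hall-no-tight (hall-upto k) L R c cond no-tight L-inhabited

  hall : ∀ L R → HallCond L R → Matching L R
  hall L R = hall-upto (count L) L R ≤-refl

-- Summing the degrees over a vertex set Z counts the
-- edge-ends lying in Z; in a cubic graph this yields 3|Z| = |∂Z| + 2·e(Z),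
-- where ∂Z is the edge-cut of Z and e(Z) the number of edges inside Z.

module EdgeCounting (G : Graph) where

  ∑ₑ : (Edge G → ℕ) → ℕ
  ∑ₑ = ∑ {m G}

  end₁ end₂ : Edge G → Vertex G
  end₁ ε = proj₁ (ends G ε)
  end₂ ε = proj₂ (ends G ε)

  degree-as-∑ : ∀ z → degree G z ≡ ∑ₑ (λ ε → indicator (eqFin z (end₁ ε)) + indicator (eqFin z (end₂ ε)))
  degree-as-∑ z = trans (sum-allFin {m G} _) (∑-cong λ ε →
    cong₂ _+_ (cong indicator (trans (≟-eqFin (end₁ ε) z) (eqFin-sym (end₁ ε) z)))
              (cong indicator (trans (≟-eqFin (end₂ ε) z) (eqFin-sym (end₂ ε) z))))

  endsIn : Pred (n G) → Edge G → ℕ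
  endsIn Z ε = indicator (Z (end₁ ε)) + indicator (Z (end₂ ε))

  degree-sum : ∀ (Z : Pred (n G)) → ∑ (λ z → indicator (Z z) * degree G z) ≡ ∑ₑ (endsIn Z)
  degree-sum Z = begin
      ∑ (λ z → indicator (Z z) * degree G z)
    ≡⟨ ∑-cong (λ z → trans (cong (indicator (Z z) *_) (degree-as-∑ z)) (sym (∑-* {m G} (indicator (Z z)) _))) ⟩
      ∑ (λ z → ∑ₑ (λ ε → indicator (Z z) * (indicator (eqFin z (end₁ ε)) + indicator (eqFin z (end₂ ε)))))
    ≡⟨ ∑-swap {k = m G} (λ z ε → indicator (Z z) * (indicator (eqFin z (end₁ ε)) + indicator (eqFin z (end₂ ε)))) ⟩
      ∑ₑ (λ ε → ∑ (λ z → indicator (Z z) * (indicator (eqFin z (end₁ ε)) + indicator (eqFin z (end₂ ε)))))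
    ≡⟨ ∑-cong per-edge ⟩
      ∑ₑ (endsIn Z)
    ∎
    where
    open ≡-Reasoning
    at : ∀ z p → indicator (Z z) * indicator (eqFin z p) ≡ indicator (eqFin p z) * indicator (Z z)
    at z p = trans (*-comm (indicator (Z z)) _) (cong (λ b → indicator b * indicator (Z z)) (eqFin-sym z p))
    per-edge : ∀ ε → ∑ (λ z → indicator (Z z) * (indicator (eqFin z (end₁ ε)) + indicator (eqFin z (end₂ ε)))) ≡ endsIn Z ε
    per-edge ε = begin
        ∑ (λ z → indicator (Z z) * (indicator (eqFin z (end₁ ε)) + indicator (eqFin z (end₂ ε))))
      ≡⟨ ∑-cong (λ z → trans (*-distribˡ-+ (indicator (Z z)) _ _) (cong₂ _+_ (at z (end₁ ε)) (at z (end₂ ε)))) ⟩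
        ∑ (λ z → indicator (eqFin (end₁ ε) z) * indicator (Z z) + indicator (eqFin (end₂ ε) z) * indicator (Z z))
      ≡⟨ ∑-+ {n G} _ _ ⟩
        ∑ (λ z → indicator (eqFin (end₁ ε) z) * indicator (Z z)) + ∑ (λ z → indicator (eqFin (end₂ ε) z) * indicator (Z z))
      ≡⟨ cong₂ _+_ (∑-delta (λ z → indicator (Z z)) (end₁ ε)) (∑-delta (λ z → indicator (Z z)) (end₂ ε)) ⟩
        endsIn Z ε
      ∎

  cubic-ends : Cubic G → ∀ (Z : Pred (n G)) → ∑ₑ (endsIn Z) ≡ 3 * count Z
  cubic-ends cubic Z = begin
    ∑ₑ (endsIn Z)                             ≡⟨ sym (degree-sum Z) ⟩
    ∑ (λ z → indicator (Z z) * degree G z)   ≡⟨ ∑-cong (λ z → trans (cong (indicator (Z z) *_) (cubic z)) (*-comm (indicator (Z z)) 3)) ⟩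
    ∑ (λ z → 3 * indicator (Z z))            ≡⟨ ∑-* 3 (λ z → indicator (Z z)) ⟩
    3 * count Z                              ∎
    where open ≡-Reasoning

  inCut inside : Pred (n G) → Edge G → Bool
  inCut P ε = P (end₁ ε) xor P (end₂ ε)
  inside P ε = P (end₁ ε) ∧ P (end₂ ε)

  cut : Pred (n G) → ℕ
  cut P = count (inCut P)

  innerEdges : Pred (n G) → ℕ
  innerEdges P = count (inside P)

  cutSize-toSubset : ∀ P → cutSize G (toSubset P) ≡ cut P
  cutSize-toSubset P = trans (sum-allFin {m G} _)
    (∑-cong λ ε → cong indicator (cong₂ _xor_ (∈?-toSubset P (end₁ ε)) (∈?-toSubset P (end₂ ε))))

  cut-complement : ∀ P → cut (λ z → not (P z)) ≡ cut P
  cut-complement P = ∑-cong (λ ε → cong indicator (xor-not (P (end₁ ε)) (P (end₂ ε))))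
    where
    xor-not : ∀ a b → not a xor not b ≡ a xor b
    xor-not false false = refl
    xor-not false true = refl
    xor-not true false = refl
    xor-not true true = refl

  cubic-cut-identity : Cubic G → ∀ P → 3 * count P ≡ cut P + 2 * innerEdges P
  cubic-cut-identity cubic P = begin
    3 * count P                                                 ≡⟨ sym (cubic-ends cubic P) ⟩
    ∑ₑ (endsIn P)                                                ≡⟨ ∑-cong (λ ε → ends-split (P (end₁ ε)) (P (end₂ ε))) ⟩
    ∑ₑ (λ ε → indicator (inCut P ε) + 2 * indicator (inside P ε)) ≡⟨ ∑-+ {m G} _ _ ⟩
    cut P + ∑ₑ (λ ε → 2 * indicator (inside P ε))                ≡⟨ cong (cut P +_) (∑-* {m G} 2 _) ⟩
    cut P + 2 * innerEdges P                                    ∎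
    where
    open ≡-Reasoning
    ends-split : ∀ a b → indicator a + indicator b ≡ indicator (a xor b) + 2 * indicator (a ∧ b)
    ends-split false false = refl
    ends-split false true = refl
    ends-split true false = refl
    ends-split true true = refl

-- A set of s ≥ 2 vertices with at most 3 outgoing edges in a cubic graph
-- spans at least s edges: 3s = c + 2e with c ≤ 3 forces e ≥ s.
dense-if-small-cut : ∀ c s e → 2 ≤ s → c ≤ 3 → 3 * s ≡ c + 2 * e → s ≤ e
dense-if-small-cut c s e s≥2 c≤3 identity with s ≤? e
... | yes s≤e = s≤e
... | no s≰e = ⊥-elim (1+n≰n (≤-trans (+-monoˡ-≤ 2 s≥2) (+-cancelʳ-≤ (2 * s) (s + 2) 3 chain)))
  where
  open ≤-Reasoning
  regroup₁ : ∀ s → s + 2 + 2 * s ≡ 3 * s + 2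
  regroup₁ = solve-∀
  regroup₂ : ∀ e → 3 + 2 * e + 2 ≡ 3 + 2 * suc e
  regroup₂ = solve-∀
  chain : s + 2 + 2 * s ≤ 3 + 2 * s
  chain = begin
     s + 2 + 2 * s      ≡⟨ regroup₁ s ⟩
     3 * s + 2          ≡⟨ cong (_+ 2) identity ⟩
     c + 2 * e + 2      ≤⟨ +-monoˡ-≤ 2 (+-monoˡ-≤ (2 * e) c≤3) ⟩
     3 + 2 * e + 2      ≡⟨ regroup₂ e ⟩
     3 + 2 * suc e      ≤⟨ +-monoʳ-≤ 3 (*-monoʳ-≤ 2 (≰⇒> s≰e)) ⟩
     3 + 2 * s          ∎

-- In a loopless graph, a vertex set P spanning at least as many
-- edges as it has vertices contains a cycle: delete vertices of inner degree
-- at most one (this keeps the inequality) until every vertex has inner degree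
-- at least two; then a walk that never leaves by the edge it came in on must
-- revisit a vertex, and its first repetition closes a cycle.

joins-shared-end : ∀ (G : Graph) ε u₁ v₁ u₂ v₂ → Joins G ε u₁ v₁ → Joins G ε u₂ v₂ → (u₁ ≡ u₂) ⊎ (v₁ ≡ u₂)
joins-shared-end G ε u₁ v₁ u₂ v₂ (inj₁ e₁) (inj₁ e₂) = inj₁ (cong proj₁ (trans (sym e₁) e₂))
joins-shared-end G ε u₁ v₁ u₂ v₂ (inj₁ e₁) (inj₂ e₂) = inj₂ (cong proj₂ (trans (sym e₁) e₂))
joins-shared-end G ε u₁ v₁ u₂ v₂ (inj₂ e₁) (inj₁ e₂) = inj₂ (cong proj₁ (trans (sym e₁) e₂))
joins-shared-end G ε u₁ v₁ u₂ v₂ (inj₂ e₁) (inj₂ e₂) = inj₁ (cong proj₂ (trans (sym e₁) e₂))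

toℕ-next-< : ∀ {k} (r : Fin (suc k)) → toℕ r < k → toℕ (next r) ≡ suc (toℕ r)
toℕ-next-< {k} r h = trans (FP.toℕ-fromℕ< _) (m<n⇒m%n≡m (s≤s h))

toℕ-next-last : ∀ {k} (r : Fin (suc k)) → toℕ r ≡ k → toℕ (next r) ≡ 0
toℕ-next-last {k} r h = trans (FP.toℕ-fromℕ< _) (trans (cong (λ z → suc z % suc k) h) (n%n≡0 (suc k)))

module CycleFromWalk (G : Graph) (x : ℕ → Vertex G) (edge : ℕ → Edge G)
  (walk-joins : ∀ t → Joins G (edge (suc t)) (x t) (x (suc t)))
  (no-backtrack : ∀ t → edge (suc t) ≢ edge t) where

  extract : ∀ i k → x i ≡ x (i + suc k) → (∀ j → j < i + suc k → ∀ i' → i' < j → x i' ≢ x j) →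
            Σ (Cycle G k) λ C → ∀ r → Cycle.vs C r ≡ x (i + toℕ r)
  extract i k closed distinct =
    record { vs = vs ; es = es ; vs-inj = vs-inj ; es-inj = es-inj ; joins = joins } , λ r → refl
    where
    vs : Fin (suc k) → Vertex G
    vs r = x (i + toℕ r)
    es : Fin (suc k) → Edge G
    es r = edge (suc (i + toℕ r))
    bound : ∀ (r : Fin (suc k)) → i + toℕ r < i + suc k
    bound r = +-monoʳ-< i (FP.toℕ<n r)
    shift : ∀ {r r' : Fin (suc k)} → toℕ r < toℕ r' → i + toℕ r < i + toℕ r'
    shift h = +-monoʳ-< i h
    vs-inj : ∀ {r r'} → vs r ≡ vs r' → r ≡ r'
    vs-inj {r} {r'} e with <-cmp (toℕ r) (toℕ r')
    ... | tri< h _ _ = ⊥-elim (distinct (i + toℕ r') (bound r') (i + toℕ r) (shift h) e)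
    ... | tri≈ _ h _ = FP.toℕ-injective h
    ... | tri> _ _ h = ⊥-elim (distinct (i + toℕ r) (bound r) (i + toℕ r') (shift h) (sym e))
    -- an edge used at steps A < B would make x repeat before the end of the segment
    edges-distinct : ∀ A B → A < B → B < i + suc k → edge (suc A) ≢ edge (suc B)
    edges-distinct A B A<B B-bound e
      with joins-shared-end G (edge (suc B)) (x A) (x (suc A)) (x B) (x (suc B))
             (subst (λ z → Joins G z (x A) (x (suc A))) e (walk-joins A)) (walk-joins B)
    ... | inj₁ q = distinct B B-bound A A<B q
    ... | inj₂ q with m≤n⇒m<n∨m≡n A<B
    ... | inj₁ h = distinct B B-bound (suc A) h q
    ... | inj₂ refl = no-backtrack (suc A) (sym e)
    es-inj : ∀ {r r'} → es r ≡ es r' → r ≡ r'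
    es-inj {r} {r'} e with <-cmp (toℕ r) (toℕ r')
    ... | tri< h _ _ = ⊥-elim (edges-distinct (i + toℕ r) (i + toℕ r') (shift h) (bound r') e)
    ... | tri≈ _ h _ = FP.toℕ-injective h
    ... | tri> _ _ h = ⊥-elim (edges-distinct (i + toℕ r') (i + toℕ r) (shift h) (bound r) (sym e))
    joins : ∀ r → Joins G (es r) (vs r) (vs (next r))
    joins r with m≤n⇒m<n∨m≡n (≤-pred (FP.toℕ<n r))
    ... | inj₁ h = subst (Joins G (es r) (vs r))
                     (cong x (trans (sym (+-suc i (toℕ r))) (cong (i +_) (sym (toℕ-next-< r h)))))
                     (walk-joins (i + toℕ r))
    ... | inj₂ h = subst (Joins G (es r) (vs r))
                     (trans (cong x (trans (sym (+-suc i (toℕ r))) (cong (λ z → i + suc z) h)))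
                       (trans (sym closed) (cong x (trans (sym (+-identityʳ i)) (cong (i +_) (sym (toℕ-next-last r h)))))))
                     (walk-joins (i + toℕ r))

firstTrue : (f : ℕ → Bool) → ∀ k → (∀ j → j < k → f j ≡ false) ⊎
            (Σ ℕ λ j → (j < k) × (f j ≡ true) × (∀ j' → j' < j → f j' ≡ false))
firstTrue f zero = inj₁ (λ j ())
firstTrue f (suc k) with firstTrue f k
... | inj₂ (j , j<k , fj , before) = inj₂ (j , m<n⇒m<1+n j<k , fj , before)
... | inj₁ none with f k in fk
... | true = inj₂ (k , n<1+n k , fk , none)
... | false = inj₁ λ j j<1+k → below-or-at j (m<1+n⇒m<n∨m≡n j<1+k)
  where
  below-or-at : ∀ j → (j < k) ⊎ (j ≡ k) → f j ≡ false
  below-or-at j (inj₁ h) = none j h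
  below-or-at j (inj₂ refl) = fk

module Cycles (G : Graph) (loopless : ∀ ε → proj₁ (ends G ε) ≢ proj₂ (ends G ε)) where
  open EdgeCounting G

  incident? : Edge G → Vertex G → Bool
  incident? ε s = eqFin s (end₁ ε) ∨ eqFin s (end₂ ε)

  innerDegree : Pred (n G) → Vertex G → ℕ
  innerDegree P s = count (λ ε → inside P ε ∧ incident? ε s)

  CycleIn : Pred (n G) → Set
  CycleIn P = Σ ℕ λ k → Σ (Cycle G k) λ C → ∀ i → P (Cycle.vs C i) ≡ true

  CycleIn⇒HasCycleIn : ∀ P → CycleIn P → HasCycleIn G (toSubset P)
  CycleIn⇒HasCycleIn P (k , C , on) = k , C , λ i → toSubset-∈ P _ (on i)

  CycleIn⇒HasCycleIn-∁ : ∀ P → CycleIn (λ z → not (P z)) → HasCycleIn G (∁ (toSubset P))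
  CycleIn⇒HasCycleIn-∁ P (k , C , on) = k , C , λ i → toSubset-∉ P _ (not-t (on i))

  module Walk (P : Pred (n G)) (deg≥2 : ∀ s → P s ≡ true → 2 ≤ innerDegree P s)
              (s₀ : Vertex G) (Ps₀ : P s₀ ≡ true) where
    at : Vertex G → Edge G → Bool
    at s ε = inside P ε ∧ incident? ε s

    another-edge : ∀ s → P s ≡ true → ∀ ε → Σ (Edge G) λ ε' → (at s ε' ≡ true) × (ε' ≢ ε)
    another-edge s Ps ε = proj₁ found , ∧-l (proj₂ found) , eqFin-false⇒≢ ∘≢
      where
      found = count-pos _ (≤-pred (≤-trans (deg≥2 s Ps) (count-remove≤ (at s) ε)))
      ∘≢ : eqFin (proj₁ found) ε ≡ false
      ∘≢ = trans (eqFin-sym _ ε) (not-t (∧-r {at s (proj₁ found)} (proj₂ found)))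

    opposite : Vertex G → Edge G → Vertex G
    opposite s ε' = if eqFin s (end₁ ε') then end₂ ε' else end₁ ε'

    opposite-in : ∀ s ε' → inside P ε' ≡ true → P (opposite s ε') ≡ true
    opposite-in s ε' h with eqFin s (end₁ ε')
    ... | true = ∧-r {P (end₁ ε')} h
    ... | false = ∧-l h

    opposite-incident : ∀ s ε' → incident? ε' (opposite s ε') ≡ true
    opposite-incident s ε' with eqFin s (end₁ ε')
    ... | true = ∨-r (eqFin-refl (end₂ ε'))
    ... | false = ∨-l (eqFin-refl (end₁ ε'))

    opposite-joins : ∀ s ε' → incident? ε' s ≡ true → Joins G ε' s (opposite s ε')
    opposite-joins s ε' h with eqFin s (end₁ ε') in e
    ... | true = inj₁ (cong (λ z → z , end₂ ε') (sym (eqFin⇒≡ s (end₁ ε') e)))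
    ... | false = inj₂ (cong (λ z → end₁ ε' , z) (sym (eqFin⇒≡ s (end₂ ε') h)))

    -- a vertex of P together with the inner edge by which it was entered
    State : Set
    State = Σ (Vertex G) λ s → Σ (Edge G) λ ε → (P s ≡ true) × (at s ε ≡ true)

    step : State → State
    step (s , ε , Ps , _) = let (ε' , at-ε' , _) = another-edge s Ps ε in
      opposite s ε' , ε' , opposite-in s ε' (∧-l at-ε') , ∧-i (∧-l at-ε') (opposite-incident s ε')

    walk : ℕ → State
    walk zero = let (ε , at-ε) = count-pos (at s₀) (≤-trans (s≤s z≤n) (deg≥2 s₀ Ps₀)) in s₀ , ε , Ps₀ , at-ε
    walk (suc t) = step (walk t)

    x : ℕ → Vertex G
    x t = proj₁ (walk t)
    edge : ℕ → Edge G
    edge t = proj₁ (proj₂ (walk t))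
    x-in : ∀ t → P (x t) ≡ true
    x-in t = proj₁ (proj₂ (proj₂ (walk t)))

    walk-joins : ∀ t → Joins G (edge (suc t)) (x t) (x (suc t))
    walk-joins t = opposite-joins (x t) (edge (suc t))
      (∧-r {inside P (edge (suc t))} (proj₁ (proj₂ (another-edge (x t) (x-in t) (edge t)))))

    no-backtrack : ∀ t → edge (suc t) ≢ edge t
    no-backtrack t = proj₂ (proj₂ (another-edge (x t) (x-in t) (edge t)))

    repeats : ℕ → Bool
    repeats j = anyF {j} (λ i → eqFin (x (toℕ i)) (x j))

    repeats-intro : ∀ i j → i < j → x i ≡ x j → repeats j ≡ true
    repeats-intro i j i<j e = anyF-intro _ (fromℕ< i<j)
      (subst (λ z → eqFin (x z) (x j) ≡ true) (sym (FP.toℕ-fromℕ< i<j))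
             (subst (λ z → eqFin z (x j) ≡ true) (sym e) (eqFin-refl (x j))))

    open CycleFromWalk G x edge walk-joins no-backtrack

    -- Among x 0 … x (n G) some vertex repeats (pigeonhole); the first
    -- repetition x j' = x i' yields the cycle x i' … x j'.
    findCycle : CycleIn P
    findCycle with FP.pigeonhole (n<1+n (n G)) (λ r → x (toℕ r))
    ... | i , j , i<j , e with firstTrue repeats (suc (toℕ j))
    ... | inj₁ none = ⊥-elim (t≢f (repeats-intro (toℕ i) (toℕ j) i<j e) (none (toℕ j) (n<1+n _)))
    ... | inj₂ (j' , _ , rj' , first) with anyF-elim (λ i → eqFin (x (toℕ i)) (x j')) rj'
    ... | i' , ei' = k , proj₁ C , λ r → subst (λ z → P z ≡ true) (sym (proj₂ C r)) (x-in (toℕ i' + toℕ r))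
      where
      k = j' ∸ suc (toℕ i')
      j'≡ : toℕ i' + suc k ≡ j'
      j'≡ = trans (+-suc (toℕ i') k) (m+[n∸m]≡n (FP.toℕ<n i'))
      distinct : ∀ j'' → j'' < j' → ∀ i'' → i'' < j'' → x i'' ≢ x j''
      distinct j'' h i'' h' e' = t≢f (repeats-intro i'' j'' h' e') (first j'' h)
      C = extract (toℕ i') k (trans (eqFin⇒≡ _ _ ei') (cong x (sym j'≡)))
                  (λ j'' h → distinct j'' (subst (j'' <_) j'≡ h))

  inner-remove : ∀ P s → innerEdges P ≤ innerEdges (λ z → P z ∧ not (eqFin s z)) + innerDegree P s
  inner-remove P s = ≤-trans (∑-mono (λ ε → per-edge (P (end₁ ε)) (P (end₂ ε)) (eqFin s (end₁ ε)) (eqFin s (end₂ ε))))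
                             (≤-reflexive (∑-+ {m G} _ _))
    where
    per-edge : ∀ a b x y → indicator (a ∧ b) ≤ indicator ((a ∧ not x) ∧ (b ∧ not y)) + indicator ((a ∧ b) ∧ (x ∨ y))
    per-edge false b x y = z≤n
    per-edge true false x y = z≤n
    per-edge true true false false = s≤s z≤n
    per-edge true true false true = ≤-refl
    per-edge true true true y = ≤-refl

  lowIn : Pred (n G) → Pred (n G)
  lowIn P s = P s ∧ leb (innerDegree P s) 1

  cycle-in-dense-upto : ∀ fuel P → count P ≤ fuel → count P ≤ innerEdges P → 1 ≤ count P → CycleIn P
  cycle-in-dense-upto zero P c dense P-inhabited = ⊥-elim (1+n≰n (≤-trans P-inhabited c))
  cycle-in-dense-upto (suc fuel) P c dense P-inhabited
    with anyF (lowIn P) in low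
  ... | false = Walk.findCycle P deg≥2 (proj₁ s₀) (proj₂ s₀)
    where
    s₀ = count-pos P P-inhabited
    deg≥2 : ∀ s → P s ≡ true → 2 ≤ innerDegree P s
    deg≥2 s Ps = leb-false⇒> (innerDegree P s) 1 (∧-false (anyF-false⁻ (lowIn P) low s) Ps)
  ... | true = let (k , C , on) = cycle-in-dense-upto fuel P' c' dense' P'-inhabited in k , C , λ i → ∧-l (on i)
    where
    s = proj₁ (anyF-elim (lowIn P) low)
    Ps : P s ≡ true
    Ps = ∧-l (proj₂ (anyF-elim (lowIn P) low))
    deg≤1 : innerDegree P s ≤ 1
    deg≤1 = leb⇒≤ _ _ (∧-r {P s} (proj₂ (anyF-elim (lowIn P) low)))
    P' : Pred (n G)
    P' z = P z ∧ not (eqFin s z)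
    |P| : count P ≡ suc (count P')
    |P| = count-remove P s Ps
    -- P spans an edge, whose ends are distinct
    P≥2 : 2 ≤ count P
    P≥2 = let (ε , in-ε) = count-pos (inside P) (≤-trans P-inhabited dense) in
          count≥2 P (end₁ ε) (end₂ ε) (loopless ε) (∧-l in-ε) (∧-r {P (end₁ ε)} in-ε)
    dense' : count P' ≤ innerEdges P'
    dense' = ≤-pred (begin
      suc (count P')                   ≡⟨ sym |P| ⟩
      count P                          ≤⟨ dense ⟩
      innerEdges P                     ≤⟨ inner-remove P s ⟩
      innerEdges P' + innerDegree P s  ≤⟨ +-monoʳ-≤ (innerEdges P') deg≤1 ⟩
      innerEdges P' + 1                ≡⟨ +-comm (innerEdges P') 1 ⟩
      suc (innerEdges P')              ∎)
      where open ≤-Reasoning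
    P'-inhabited : 1 ≤ count P'
    P'-inhabited = ≤-pred (subst (2 ≤_) |P| P≥2)
    c' : count P' ≤ fuel
    c' = ≤-pred (subst (_≤ suc fuel) |P| c)

  cycle-in-dense : ∀ P → count P ≤ innerEdges P → 1 ≤ count P → CycleIn P
  cycle-in-dense P = cycle-in-dense-upto (count P) P ≤-refl

-- This is the per-edge form of the
-- inequality |∂(X ∪ N(X))| + 3|X| ≤ 3|N(X)| in a cubic bipartite graph.
cut-ends-bound : ∀ xp xq bp bq → (xp ≡ true → bq ≡ true) → (xq ≡ true → bp ≡ true) →
  (xp ≡ true → bp ≡ false) → (xq ≡ true → bq ≡ false) →
  indicator ((xp ∨ bp) xor (xq ∨ bq)) + (indicator xp + indicator xq) ≤ indicator bp + indicator bq
cut-ends-bound false false false false _ _ _ _ = z≤n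
cut-ends-bound false false false true _ _ _ _ = ≤-refl
cut-ends-bound false false true false _ _ _ _ = ≤-refl
cut-ends-bound false false true true _ _ _ _ = z≤n
cut-ends-bound true false false true _ _ _ _ = ≤-refl
cut-ends-bound false true true false _ _ _ _ = ≤-refl
cut-ends-bound true xq bp false p→q _ _ _ with p→q refl
... | ()
cut-ends-bound true xq true bq _ _ p-disj _ with p-disj refl
... | ()
cut-ends-bound xp true false bq _ q→p _ _ with q→p refl
... | ()
cut-ends-bound xp true bp true _ _ _ q-disj with q-disj refl
... | ()

true-other-false : ∀ {a b} → a ≡ true → a ≢ b → b ≡ false
true-other-false {b = false} refl _ = refl
true-other-false {b = true} refl a≢b = ⊥-elim (a≢b refl)

false-other-true : ∀ {a b} → a ≡ false → a ≢ b → b ≡ true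
false-other-true {b = true} refl _ = refl
false-other-true {b = false} refl a≢b = ⊥-elim (a≢b refl)

module CubicBipartite (G : Graph) (cubic : Cubic G) (colour : Vertex G → Bool)
       (proper : (ε : Edge G) → colour (proj₁ (ends G ε)) ≢ colour (proj₂ (ends G ε)))
       (cyc4 : Cyclically4EdgeConnected G) where
  open EdgeCounting G

  loopless : ∀ ε → end₁ ε ≢ end₂ ε
  loopless ε h = proper ε (cong colour h)

  open Cycles G loopless

  Joins-swap : ∀ {ε a b} → Joins G ε a b → Joins G ε b a
  Joins-swap (inj₁ h) = inj₂ h
  Joins-swap (inj₂ h) = inj₁ h

  Joins⇒Incident : ∀ ε a b → Joins G ε a b → Incident G ε a × Incident G ε b
  Joins⇒Incident ε a b (inj₁ h) = inj₁ (cong proj₁ h) , inj₂ (cong proj₂ h)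
  Joins⇒Incident ε a b (inj₂ h) = inj₂ (cong proj₂ h) , inj₁ (cong proj₁ h)

  Incident⇒end : ∀ ε a b z → Joins G ε a b → Incident G ε z → (z ≡ a) ⊎ (z ≡ b)
  Incident⇒end ε a b z (inj₁ h) (inj₁ i) = inj₁ (trans (sym i) (cong proj₁ h))
  Incident⇒end ε a b z (inj₁ h) (inj₂ i) = inj₂ (trans (sym i) (cong proj₂ h))
  Incident⇒end ε a b z (inj₂ h) (inj₁ i) = inj₂ (trans (sym i) (cong proj₁ h))
  Incident⇒end ε a b z (inj₂ h) (inj₂ i) = inj₁ (trans (sym i) (cong proj₂ h))

  joins-colour : ∀ {ε a b} → Joins G ε a b → colour a ≡ true → colour b ≡ false
  joins-colour {ε} (inj₁ h) ca = true-other-false ca λ e →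
    proper ε (subst₂ (λ p q → colour p ≡ colour q) (sym (cong proj₁ h)) (sym (cong proj₂ h)) e)
  joins-colour {ε} (inj₂ h) ca = true-other-false ca λ e →
    proper ε (subst₂ (λ p q → colour p ≡ colour q) (sym (cong proj₁ h)) (sym (cong proj₂ h)) (sym e))

  joins? : Edge G → Vertex G → Vertex G → Bool
  joins? ε a b = (eqFin a (end₁ ε) ∧ eqFin b (end₂ ε)) ∨ (eqFin b (end₁ ε) ∧ eqFin a (end₂ ε))

  adjacent : Vertex G → Vertex G → Bool
  adjacent a b = anyF (λ ε → joins? ε a b)

  joins?⇒Joins : ∀ ε a b → joins? ε a b ≡ true → Joins G ε a b
  joins?⇒Joins ε a b h with eqFin a (end₁ ε) ∧ eqFin b (end₂ ε) in forward
  ... | true = inj₁ (cong₂ _,_ (sym (eqFin⇒≡ _ _ (∧-l forward))) (sym (eqFin⇒≡ _ _ (∧-r {eqFin a (end₁ ε)} forward))))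
  ... | false = inj₂ (cong₂ _,_ (sym (eqFin⇒≡ _ _ (∧-l h))) (sym (eqFin⇒≡ _ _ (∧-r {eqFin b (end₁ ε)} h))))

  Joins⇒adjacent : ∀ ε a b → Joins G ε a b → adjacent a b ≡ true
  Joins⇒adjacent ε a b J = anyF-intro (λ ε → joins? ε a b) ε (by-orientation J)
    where
    by-orientation : Joins G ε a b → joins? ε a b ≡ true
    by-orientation (inj₁ refl) rewrite eqFin-refl a | eqFin-refl b = refl
    by-orientation (inj₂ refl) rewrite eqFin-refl a | eqFin-refl b = ∨-r {eqFin a b ∧ eqFin b a} refl

  -- Both colour classes have the same size: each edge has one end in each,
  -- so both have 3|class| = m ends.
  colour-classes-equal : count colour ≡ count (λ z → not (colour z))
  colour-classes-equal = *-cancelˡ-≡ (count colour) _ 3 (begin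
      3 * count colour                    ≡⟨ sym (cubic-ends cubic colour) ⟩
      ∑ₑ (endsIn colour)                   ≡⟨ ∑-cong (λ ε → trans (one-end (proper ε)) (sym (one-end (not-≢ (proper ε))))) ⟩
      ∑ₑ (endsIn (λ z → not (colour z)))   ≡⟨ cubic-ends cubic (λ z → not (colour z)) ⟩
      3 * count (λ z → not (colour z))    ∎)
    where
    open ≡-Reasoning
    one-end : ∀ {a b} → a ≢ b → indicator a + indicator b ≡ 1
    one-end {false} {false} h = ⊥-elim (h refl)
    one-end {false} {true} h = refl
    one-end {true} {false} h = refl
    one-end {true} {true} h = ⊥-elim (h refl)
    not-≢ : ∀ {a b} → a ≢ b → not a ≢ not b
    not-≢ {false} {false} h _ = h refl
    not-≢ {false} {true} h ()
    not-≢ {true} {false} h ()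
    not-≢ {true} {true} h _ = h refl

  -- A vertex has at most 3 neighbours: each neighbour needs an edge-end at a.
  neighbours≤3 : ∀ a → count (adjacent a) ≤ 3
  neighbours≤3 a = begin
      count (adjacent a)                              ≤⟨ ∑-mono (λ z → indicator-anyF (λ ε → joins? ε a z)) ⟩
      ∑ (λ z → ∑ₑ (λ ε → indicator (joins? ε a z)))   ≡⟨ ∑-swap (λ z ε → indicator (joins? ε a z)) ⟩
      ∑ₑ (λ ε → ∑ (λ z → indicator (joins? ε a z)))   ≤⟨ ∑-mono per-edge ⟩
      ∑ₑ (λ ε → indicator (eqFin a (end₁ ε)) + indicator (eqFin a (end₂ ε))) ≡⟨ sym (degree-as-∑ a) ⟩
      degree G a                                      ≡⟨ cubic a ⟩
      3                                               ∎
    where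
    open ≤-Reasoning
    per-edge : ∀ ε → ∑ (λ z → indicator (joins? ε a z)) ≤ indicator (eqFin a (end₁ ε)) + indicator (eqFin a (end₂ ε))
    per-edge ε = ≤-trans (∑-mono (λ z → indicator-∨ (eqFin a (end₁ ε) ∧ eqFin z (end₂ ε)) (eqFin z (end₁ ε) ∧ eqFin a (end₂ ε))))
      (≤-reflexive (trans (∑-+ {n G} _ _) (cong₂ _+_
        (trans (∑-cong (λ z → trans (indicator-∧ (eqFin a (end₁ ε)) (eqFin z (end₂ ε)))
                                    (cong (λ t → indicator t * indicator (eqFin a (end₁ ε))) (eqFin-sym z (end₂ ε)))))
               (∑-delta (λ _ → indicator (eqFin a (end₁ ε))) (end₂ ε)))
        (trans (∑-cong (λ z → trans (indicator-∧ (eqFin z (end₁ ε)) (eqFin a (end₂ ε)))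
                                    (trans (*-comm (indicator (eqFin a (end₂ ε))) _)
                                           (cong (λ t → indicator t * indicator (eqFin a (end₂ ε))) (eqFin-sym z (end₁ ε))))))
               (∑-delta (λ _ → indicator (eqFin a (end₂ ε))) (end₁ ε))))))

  -- Let e = uv and f = xy with u, x true, u ≠ x and v ≠ y.
  -- Then G has a perfect matching containing e and f: the true vertices
  -- other than u, x (the set L) can be matched into the false vertices other
  -- than v, y (the set R) by Hall's theorem, and since |L| = |R| this matching
  -- covers R as well.
  module MatchingThroughTwoEdges (u v x y : Vertex G) (e f : Edge G)
         (uv : Joins G e u v) (xy : Joins G f x y) (u-true : colour u ≡ true) (x-true : colour x ≡ true)
         (u≢x : u ≢ x) (v≢y : v ≢ y) where

    v-false : colour v ≡ false
    v-false = joins-colour uv u-true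
    y-false : colour y ≡ false
    y-false = joins-colour xy x-true

    L R : Pred (n G)
    L a = colour a ∧ (not (eqFin u a) ∧ not (eqFin x a))
    R b = not (colour b) ∧ (not (eqFin v b) ∧ not (eqFin y b))

    open Hall adjacent

    L-true : ∀ a → L a ≡ true → colour a ≡ true
    L-true a h = ∧-l h
    R-false : ∀ a → R a ≡ true → colour a ≡ false
    R-false a h = not-t (∧-l h)
    u∉L : L u ≡ false
    u∉L = not-true λ h → t≢f (eqFin-refl u) (not-t (∧-l (∧-r {colour u} h)))
    x∉L : L x ≡ false
    x∉L = not-true λ h → t≢f (eqFin-refl x) (not-t (∧-r {not (eqFin u x)} (∧-r {colour x} h)))
    v∉R : R v ≡ false
    v∉R = not-true λ h → t≢f (eqFin-refl v) (not-t (∧-l (∧-r {not (colour v)} h)))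
    y∉R : R y ≡ false
    y∉R = not-true λ h → t≢f (eqFin-refl y) (not-t (∧-r {not (eqFin v y)} (∧-r {not (colour y)} h)))

    -- A violator X ⊆ L of Hall's condition yields a cyclic cut of size at most 3.
    module HallViolator (X : Pred (n G)) (X⊆L : X ⊆ L) (deficient : suc (count (Nb R X)) ≤ count X) where
      -- B = N_R(X) ∪ {v, y} is the full false neighbourhood of X; S = X ∪ B.
      B S T : Pred (n G)
      B b = Nb R X b ∨ (eqFin v b ∨ eqFin y b)
      S z = X z ∨ B z
      T z = not (S z)

      X-true : ∀ a → X a ≡ true → colour a ≡ true
      X-true a h = L-true a (X⊆L a h)

      B-false : ∀ b → B b ≡ true → colour b ≡ false
      B-false b h with Nb R X b in nb
      ... | true = R-false b (∧-l nb)
      ... | false with eqFin v b in vb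
      ... | true = subst (λ w → colour w ≡ false) (eqFin⇒≡ _ _ vb) v-false
      ... | false = subst (λ w → colour w ≡ false) (eqFin⇒≡ _ _ h) y-false

      X∩B-empty : ∀ z → X z ≡ true → B z ≡ false
      X∩B-empty z xz = not-true λ bz → t≢f (X-true z xz) (B-false z bz)

      neighbour-in-B : ∀ ε a b → Joins G ε a b → X a ≡ true → B b ≡ true
      neighbour-in-B ε a b J xa with eqFin v b | eqFin y b
      ... | true | _ = ∨-r refl
      ... | false | true = ∨-r refl
      ... | false | false = ∨-l (∧-i (∧-i (not-f (joins-colour J (X-true a xa))) refl)
                                     (anyF-intro (λ a' → X a' ∧ adjacent a' b) a (∧-i xa (Joins⇒adjacent ε a b J))))

      cut-and-X : cut S + 3 * count X ≤ 3 * count B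
      cut-and-X = begin
        cut S + 3 * count X                              ≡⟨ cong (cut S +_) (sym (cubic-ends cubic X)) ⟩
        cut S + ∑ₑ (endsIn X)                            ≡⟨ sym (∑-+ {m G} _ _) ⟩
        ∑ₑ (λ ε → indicator (inCut S ε) + endsIn X ε)    ≤⟨ ∑-mono per-edge ⟩
        ∑ₑ (endsIn B)                                    ≡⟨ cubic-ends cubic B ⟩
        3 * count B                                      ∎
        where
        open ≤-Reasoning
        per-edge : ∀ ε → indicator (inCut S ε) + endsIn X ε ≤ endsIn B ε
        per-edge ε = cut-ends-bound (X (end₁ ε)) (X (end₂ ε)) (B (end₁ ε)) (B (end₂ ε))
          (neighbour-in-B ε _ _ (inj₁ refl)) (neighbour-in-B ε _ _ (inj₂ refl))
          (X∩B-empty (end₁ ε)) (X∩B-empty (end₂ ε))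

      B≤X+1 : count B ≤ count X + 1
      B≤X+1 = begin
        count B                            ≤⟨ count-∨ (Nb R X) _ ⟩
        count (Nb R X) + count (λ b → eqFin v b ∨ eqFin y b) ≤⟨ +-monoʳ-≤ (count (Nb R X)) (count-pair≤ v y) ⟩
        count (Nb R X) + 2                 ≡⟨ +-comm (count (Nb R X)) 2 ⟩
        suc (suc (count (Nb R X)))         ≤⟨ s≤s deficient ⟩
        suc (count X)                      ≡⟨ +-comm 1 (count X) ⟩
        count X + 1                        ∎
        where open ≤-Reasoning

      cut≤3 : cut S ≤ 3
      cut≤3 = +-cancelʳ-≤ (3 * count X) (cut S) 3 (begin
        cut S + 3 * count X    ≤⟨ cut-and-X ⟩
        3 * count B            ≤⟨ *-monoʳ-≤ 3 B≤X+1 ⟩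
        3 * (count X + 1)      ≡⟨ distribute (count X) ⟩
        3 + 3 * count X        ∎)
        where
        open ≤-Reasoning
        distribute : ∀ k → 3 * (k + 1) ≡ 3 + 3 * k
        distribute = solve-∀

      -- S contains v, y and T contains u, x, so both have two vertices.
      S≥2 : 2 ≤ count S
      S≥2 = count≥2 S v y v≢y (∨-r {X v} (∨-r {Nb R X v} (∨-l (eqFin-refl v))))
                                (∨-r {X y} (∨-r {Nb R X y} (∨-r {eqFin v y} (eqFin-refl y))))

      u-x-in-T : ∀ z → L z ≡ false → colour z ≡ true → T z ≡ true
      u-x-in-T z z∉L z-true = not-f (not-true λ sz → not-in-S sz)
        where
        not-in-S : S z ≡ true → ⊥
        not-in-S sz with X z in xz
        ... | true = t≢f (X⊆L z xz) z∉L
        ... | false = t≢f z-true (B-false z sz)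

      T≥2 : 2 ≤ count T
      T≥2 = count≥2 T u x u≢x (u-x-in-T u u∉L u-true) (u-x-in-T x x∉L x-true)

      side-cycle : ∀ P → 2 ≤ count P → cut P ≤ 3 → CycleIn P
      side-cycle P P≥2 cutP≤3 = cycle-in-dense P
        (dense-if-small-cut (cut P) (count P) (innerEdges P) P≥2 cutP≤3 (cubic-cut-identity cubic P))
        (≤-trans (s≤s z≤n) P≥2)

      impossible : ⊥
      impossible = 1+n≰n (≤-trans (subst (4 ≤_) (cutSize-toSubset S) (cyc4 (toSubset S) cycle-S cycle-T)) cut≤3)
        where
        cycle-S = CycleIn⇒HasCycleIn S (side-cycle S S≥2 cut≤3)
        cycle-T = CycleIn⇒HasCycleIn-∁ S (side-cycle T T≥2 (subst (_≤ 3) (sym (cut-complement S)) cut≤3))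

    hall-condition : HallCond L R
    hall-condition X X⊆L with count X ≤? count (Nb R X)
    ... | yes ok = ok
    ... | no deficient = ⊥-elim (HallViolator.impossible X X⊆L (≰⇒> deficient))

    open Matching (hall L R hall-condition)

    -- |R| ≤ |L|, because both colour classes have equal size.
    R≤L : count R ≤ count L
    R≤L = +-cancelʳ-≤ 2 (count R) (count L) (begin
        count R + 2                                        ≡⟨ cong (count R +_) (sym (count-pair v y v≢y)) ⟩
        count R + count (λ b → eqFin v b ∨ eqFin y b)      ≡⟨ sym (count-∨-disjoint R _ R∩vy-empty) ⟩
        count (λ b → R b ∨ (eqFin v b ∨ eqFin y b))        ≤⟨ count-mono into-false ⟩
        count (λ b → not (colour b))                       ≡⟨ sym colour-classes-equal ⟩
        count colour                                       ≤⟨ count-mono into-L∪ux ⟩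
        count (λ a → L a ∨ (eqFin u a ∨ eqFin x a))        ≤⟨ count-∨ L _ ⟩
        count L + count (λ a → eqFin u a ∨ eqFin x a)      ≤⟨ +-monoʳ-≤ (count L) (count-pair≤ u x) ⟩
        count L + 2                                        ∎)
      where
      open ≤-Reasoning
      R∩vy-empty : ∀ b → R b ∧ (eqFin v b ∨ eqFin y b) ≡ false
      R∩vy-empty b = not-true λ h → t≢f (∧-r {R b} h)
        (cong₂ _∨_ (not-t (∧-l (∧-r {not (colour b)} (∧-l h)))) (not-t (∧-r {not (eqFin v b)} (∧-r {not (colour b)} (∧-l h)))))
      into-false : ∀ b → R b ∨ (eqFin v b ∨ eqFin y b) ≡ true → not (colour b) ≡ true
      into-false b h with R b in rb
      ... | true = ∧-l rb
      ... | false with eqFin v b in vb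
      ... | true = not-f (subst (λ w → colour w ≡ false) (eqFin⇒≡ _ _ vb) v-false)
      ... | false = not-f (subst (λ w → colour w ≡ false) (eqFin⇒≡ _ _ h) y-false)
      into-L∪ux : ∀ a → colour a ≡ true → L a ∨ (eqFin u a ∨ eqFin x a) ≡ true
      into-L∪ux a h with eqFin u a | eqFin x a
      ... | true | _ = ∨-r refl
      ... | false | true = ∨-r refl
      ... | false | false = ∨-l (∧-i h refl)

    -- The Hall matching is onto R: otherwise L would inject into R minus a point.
    mate-onto : ∀ z → R z ≡ true → Σ (Vertex G) λ a → (L a ≡ true) × (mate a ≡ z)
    mate-onto z rz with anyF (λ a → L a ∧ eqFin (mate a) z) in hit
    ... | true = let (a , h) = anyF-elim _ hit in a , ∧-l h , eqFin⇒≡ _ _ (∧-r {L a} h)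
    ... | false = ⊥-elim (1+n≰n (begin-strict
        count L                                  ≤⟨ count-injection L R-z mate into-R-z mate-inj ⟩
        count R-z                                <⟨ n<1+n _ ⟩
        suc (count R-z)                          ≡⟨ sym (count-remove R z rz) ⟩
        count R                                  ≤⟨ R≤L ⟩
        count L                                  ∎))
      where
      open ≤-Reasoning
      R-z : Pred (n G)
      R-z b = R b ∧ not (eqFin z b)
      into-R-z : ∀ a → L a ≡ true → R-z (mate a) ≡ true
      into-R-z a la = ∧-i (mate-in a la) (not-f (trans (eqFin-sym z (mate a)) (∧-false (anyF-false⁻ _ hit a) la)))

    mateEdge : Vertex G → Edge G
    mateEdge a = choose e (λ ε → joins? ε a (mate a))

    mateEdge-joins : ∀ a → L a ≡ true → Joins G (mateEdge a) a (mate a)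
    mateEdge-joins a la = joins?⇒Joins _ a (mate a) (choose-spec e (λ ε → joins? ε a (mate a)) (mate-adj a la))

    M : Pred (m G)
    M ε = eqFin e ε ∨ (eqFin f ε ∨ anyF (λ a → L a ∧ eqFin (mateEdge a) ε))

    e∈M : M e ≡ true
    e∈M = ∨-l (eqFin-refl e)
    f∈M : M f ≡ true
    f∈M = ∨-r {eqFin e f} (∨-l (eqFin-refl f))
    mateEdge∈M : ∀ a → L a ≡ true → M (mateEdge a) ≡ true
    mateEdge∈M a la = ∨-r {eqFin e _} (∨-r {eqFin f _}
      (anyF-intro (λ a' → L a' ∧ eqFin (mateEdge a') (mateEdge a)) a (∧-i la (eqFin-refl (mateEdge a)))))

    data MatchingEdge (ε : Edge G) : Set where
      is-e : ε ≡ e → MatchingEdge ε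
      is-f : ε ≡ f → MatchingEdge ε
      is-mate : ∀ a → L a ≡ true → ε ≡ mateEdge a → MatchingEdge ε

    matchingEdge : ∀ ε → M ε ≡ true → MatchingEdge ε
    matchingEdge ε h with eqFin e ε in ee
    ... | true = is-e (sym (eqFin⇒≡ _ _ ee))
    ... | false with eqFin f ε in fe
    ... | true = is-f (sym (eqFin⇒≡ _ _ fe))
    ... | false = let (a , q) = anyF-elim _ h in is-mate a (∧-l q) (sym (eqFin⇒≡ _ _ (∧-r {L a} q)))

    data EndOf (ε : Edge G) (z : Vertex G) : Set where
      end-e     : ε ≡ e → (z ≡ u) ⊎ (z ≡ v) → EndOf ε z
      end-f     : ε ≡ f → (z ≡ x) ⊎ (z ≡ y) → EndOf ε z
      end-left  : ∀ a → L a ≡ true → ε ≡ mateEdge a → z ≡ a → EndOf ε z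
      end-right : ∀ a → L a ≡ true → ε ≡ mateEdge a → z ≡ mate a → EndOf ε z

    endOf : ∀ ε z → MatchingEdge ε → Incident G ε z → EndOf ε z
    endOf ε z (is-e refl) i = end-e refl (Incident⇒end ε u v z uv i)
    endOf ε z (is-f refl) i = end-f refl (Incident⇒end ε x y z xy i)
    endOf ε z (is-mate a la refl) i with Incident⇒end ε a (mate a) z (mateEdge-joins a la) i
    ... | inj₁ q = end-left a la refl q
    ... | inj₂ q = end-right a la refl q

    uv∉L : ∀ z → (z ≡ u) ⊎ (z ≡ v) → L z ≡ true → ⊥
    uv∉L z (inj₁ refl) h = t≢f h u∉L
    uv∉L z (inj₂ refl) h = t≢f (L-true z h) v-false
    uv∉R : ∀ z → (z ≡ u) ⊎ (z ≡ v) → R z ≡ true → ⊥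
    uv∉R z (inj₁ refl) h = t≢f u-true (R-false z h)
    uv∉R z (inj₂ refl) h = t≢f h v∉R
    xy∉L : ∀ z → (z ≡ x) ⊎ (z ≡ y) → L z ≡ true → ⊥
    xy∉L z (inj₁ refl) h = t≢f h x∉L
    xy∉L z (inj₂ refl) h = t≢f (L-true z h) y-false
    xy∉R : ∀ z → (z ≡ x) ⊎ (z ≡ y) → R z ≡ true → ⊥
    xy∉R z (inj₁ refl) h = t≢f x-true (R-false z h)
    xy∉R z (inj₂ refl) h = t≢f h y∉R
    uv∩xy : ∀ z → (z ≡ u) ⊎ (z ≡ v) → (z ≡ x) ⊎ (z ≡ y) → ⊥
    uv∩xy z (inj₁ refl) (inj₁ h) = u≢x h
    uv∩xy z (inj₁ refl) (inj₂ refl) = t≢f u-true y-false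
    uv∩xy z (inj₂ refl) (inj₁ refl) = t≢f x-true v-false
    uv∩xy z (inj₂ refl) (inj₂ h) = v≢y h
    L∩R : ∀ z → L z ≡ true → R z ≡ true → ⊥
    L∩R z h₁ h₂ = t≢f (L-true z h₁) (R-false z h₂)
    left-in-L : ∀ {a z} → L a ≡ true → z ≡ a → L z ≡ true
    left-in-L h refl = h
    right-in-R : ∀ {a z} → L a ≡ true → z ≡ mate a → R z ≡ true
    right-in-R {a} h refl = mate-in a h

    unique-at : ∀ ε₁ ε₂ z → EndOf ε₁ z → EndOf ε₂ z → ε₁ ≡ ε₂
    unique-at ε₁ ε₂ z (end-e h₁ k₁) (end-e h₂ k₂) = trans h₁ (sym h₂)
    unique-at ε₁ ε₂ z (end-e h₁ k₁) (end-f h₂ k₂) = ⊥-elim (uv∩xy z k₁ k₂)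
    unique-at ε₁ ε₂ z (end-e h₁ k₁) (end-left a la h₂ k₂) = ⊥-elim (uv∉L z k₁ (left-in-L la k₂))
    unique-at ε₁ ε₂ z (end-e h₁ k₁) (end-right a la h₂ k₂) = ⊥-elim (uv∉R z k₁ (right-in-R la k₂))
    unique-at ε₁ ε₂ z (end-f h₁ k₁) (end-e h₂ k₂) = ⊥-elim (uv∩xy z k₂ k₁)
    unique-at ε₁ ε₂ z (end-f h₁ k₁) (end-f h₂ k₂) = trans h₁ (sym h₂)
    unique-at ε₁ ε₂ z (end-f h₁ k₁) (end-left a la h₂ k₂) = ⊥-elim (xy∉L z k₁ (left-in-L la k₂))
    unique-at ε₁ ε₂ z (end-f h₁ k₁) (end-right a la h₂ k₂) = ⊥-elim (xy∉R z k₁ (right-in-R la k₂))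
    unique-at ε₁ ε₂ z (end-left a la h₁ k₁) (end-e h₂ k₂) = ⊥-elim (uv∉L z k₂ (left-in-L la k₁))
    unique-at ε₁ ε₂ z (end-left a la h₁ k₁) (end-f h₂ k₂) = ⊥-elim (xy∉L z k₂ (left-in-L la k₁))
    unique-at ε₁ ε₂ z (end-left a la h₁ k₁) (end-left a' la' h₂ k₂) =
      trans h₁ (trans (cong mateEdge (trans (sym k₁) k₂)) (sym h₂))
    unique-at ε₁ ε₂ z (end-left a la h₁ k₁) (end-right a' la' h₂ k₂) = ⊥-elim (L∩R z (left-in-L la k₁) (right-in-R la' k₂))
    unique-at ε₁ ε₂ z (end-right a la h₁ k₁) (end-e h₂ k₂) = ⊥-elim (uv∉R z k₂ (right-in-R la k₁))
    unique-at ε₁ ε₂ z (end-right a la h₁ k₁) (end-f h₂ k₂) = ⊥-elim (xy∉R z k₂ (right-in-R la k₁))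
    unique-at ε₁ ε₂ z (end-right a la h₁ k₁) (end-left a' la' h₂ k₂) = ⊥-elim (L∩R z (left-in-L la' k₂) (right-in-R la k₁))
    unique-at ε₁ ε₂ z (end-right a la h₁ k₁) (end-right a' la' h₂ k₂) =
      trans h₁ (trans (cong mateEdge (mate-inj a a' la la' (trans (sym k₁) k₂))) (sym h₂))

    covering : ∀ z → Σ (Edge G) λ ε → (M ε ≡ true) × Incident G ε z × MatchingEdge ε
    covering z with u FP.≟ z
    ... | yes refl = e , e∈M , proj₁ (Joins⇒Incident e u v uv) , is-e refl
    ... | no u≢z with v FP.≟ z
    ... | yes refl = e , e∈M , proj₂ (Joins⇒Incident e u v uv) , is-e refl
    ... | no v≢z with x FP.≟ z
    ... | yes refl = f , f∈M , proj₁ (Joins⇒Incident f x y xy) , is-f refl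
    ... | no x≢z with y FP.≟ z
    ... | yes refl = f , f∈M , proj₂ (Joins⇒Incident f x y xy) , is-f refl
    ... | no y≢z with colour z in cz
    ... | true = mateEdge z , mateEdge∈M z lz , proj₁ (Joins⇒Incident _ z (mate z) (mateEdge-joins z lz)) , is-mate z lz refl
      where
      lz : L z ≡ true
      lz rewrite cz | ≢⇒eqFin-false u z u≢z | ≢⇒eqFin-false x z x≢z = refl
    ... | false = mateEdge a , mateEdge∈M a la ,
                  subst (Incident G (mateEdge a)) mate≡z (proj₂ (Joins⇒Incident _ a (mate a) (mateEdge-joins a la))) ,
                  is-mate a la refl
      where
      rz : R z ≡ true
      rz rewrite cz | ≢⇒eqFin-false v z v≢z | ≢⇒eqFin-false y z y≢z = refl
      a = proj₁ (mate-onto z rz)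
      la = proj₁ (proj₂ (mate-onto z rz))
      mate≡z = proj₂ (proj₂ (mate-onto z rz))

    perfect : IsPerfectMatching G (toSubset M)
    perfect z = ε , toSubset-∈ M ε Mε , ε-at-z , λ ε' ε'∈M ε'-at-z →
                  unique-at ε' ε z (endOf ε' z (matchingEdge ε' (toSubset-∈⁻ M ε' ε'∈M)) ε'-at-z) (endOf ε z kind ε-at-z)
      where
      ε = proj₁ (covering z)
      Mε = proj₁ (proj₂ (covering z))
      ε-at-z = proj₁ (proj₂ (proj₂ (covering z)))
      kind = proj₂ (proj₂ (proj₂ (covering z)))

  record PerfectMatchingThrough (e f : Edge G) : Set where
    field
      matching : Subset (m G)
      perfect  : IsPerfectMatching G matching
      e∈       : e ∈ matching
      f∈       : f ∈ matching

  record Oriented (ε : Edge G) : Set where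
    field
      left right : Vertex G
      joins      : Joins G ε left right
      left-true  : colour left ≡ true

  orient : ∀ ε → Oriented ε
  orient ε with colour (end₁ ε) in c₁
  ... | true = record { left = end₁ ε ; right = end₂ ε ; joins = inj₁ refl ; left-true = c₁ }
  ... | false = record { left = end₂ ε ; right = end₁ ε ; joins = inj₂ refl ; left-true = false-other-true c₁ (proper ε) }

  Far : Vertex G → Vertex G → Set
  Far a w = (w ≢ a) × (adjacent a w ≡ false)

  not-an-end : ∀ {f p q a w} → Joins G f p q → Incident G f w → Far a w → (p ≢ a) × (q ≢ a)
  not-an-end {f} {p} {q} {a} {w} pq at-w (w≢a , not-adjacent) with Incident⇒end f p q w pq at-w
  ... | inj₁ refl = w≢a , λ { refl → t≢f (Joins⇒adjacent f a w (Joins-swap pq)) not-adjacent }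
  ... | inj₂ refl = (λ { refl → t≢f (Joins⇒adjacent f a w pq) not-adjacent }) , w≢a

  record FarFromEdge (u v : Vertex G) : Set where
    field
      w     : Vertex G
      far-u : Far u w
      far-v : Far v w

  -- With at least 8 vertices some vertex is far from both ends of an edge,
  -- since the two ends have at most 6 neighbours (among them each other).
  far-vertex : 8 ≤ n G → ∀ {ε u v} → Joins G ε u v → FarFromEdge u v
  far-vertex n≥8 {ε} {u} {v} uv = record
    { w = w ; far-u = w≢u , ∨-false-l near-w ; far-v = w≢v , ∨-false-r {adjacent u w} near-w }
    where
    near : Pred (n G)
    near z = adjacent u z ∨ adjacent v z
    near≤6 : count near ≤ 6
    near≤6 = ≤-trans (count-∨ (adjacent u) (adjacent v)) (+-mono-≤ (neighbours≤3 u) (neighbours≤3 v))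
    far-exists : 1 ≤ count (λ z → not (near z))
    far-exists with 1 ≤? count (λ z → not (near z))
    ... | yes h = h
    ... | no none = ⊥-elim (1+n≰n (begin
        7                                         ≤⟨ n≤1+n 7 ⟩
        8                                         ≤⟨ n≥8 ⟩
        n G                                       ≡⟨ sym (count-all {n G}) ⟩
        count {n G} (λ _ → true)                  ≡⟨ count-split {n G} (λ _ → true) near ⟩
        count near + count (λ z → not (near z))   ≤⟨ +-mono-≤ near≤6 (≤-pred (≰⇒> none)) ⟩
        6 + 0                                     ∎))
      where open ≤-Reasoning
    w = proj₁ (count-pos (λ z → not (near z)) far-exists)
    near-w : near w ≡ false
    near-w = not-t (proj₂ (count-pos (λ z → not (near z)) far-exists))
    w≢u : w ≢ u
    w≢u w≡u = t≢f (subst (λ z → adjacent v z ≡ true) (sym w≡u) (Joins⇒adjacent ε v u (Joins-swap uv)))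
                  (∨-false-r {adjacent u w} near-w)
    w≢v : w ≢ v
    w≢v w≡v = t≢f (subst (λ z → adjacent u z ≡ true) (sym w≡v) (Joins⇒adjacent ε u v uv)) (∨-false-l near-w)

  through-edge-at : ∀ {e u v w} → Joins G e u v → colour u ≡ true → Far u w → Far v w →
                    ∀ f → Incident G f w → PerfectMatchingThrough e f
  through-edge-at {e} {u} {v} uv u-true far-u far-v f at-w = record
    { matching = toSubset M ; perfect = perfect ; e∈ = toSubset-∈ M e e∈M ; f∈ = toSubset-∈ M f f∈M }
    where
    open Oriented (orient f)
    open MatchingThroughTwoEdges u v left right e f uv joins u-true left-true
           (λ u≡x → proj₁ (not-an-end joins at-w far-u) (sym u≡x))
           (λ v≡y → proj₂ (not-an-end joins at-w far-v) (sym v≡y))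

  record ThreeEdgesAt (w : Vertex G) : Set where
    field
      f₁ f₂ f₃    : Edge G
      at₁         : Incident G f₁ w
      at₂         : Incident G f₂ w
      at₃         : Incident G f₃ w
      f₁≢f₂       : f₁ ≢ f₂
      f₁≢f₃       : f₁ ≢ f₃
      f₂≢f₃       : f₂ ≢ f₃

  three-edges-at : ∀ w → ThreeEdgesAt w
  three-edges-at w =
    let (f₁ , f₂ , f₃ , (i₁ , i₂ , i₃) , (f₁≢f₂ , f₁≢f₃ , f₂≢f₃)) =
          three-witnesses (λ ε → incident? ε w) (≤-reflexive (sym edges-at-w))
    in record { f₁ = f₁ ; f₂ = f₂ ; f₃ = f₃ ; at₁ = incident?⇒Incident f₁ i₁ ; at₂ = incident?⇒Incident f₂ i₂
              ; at₃ = incident?⇒Incident f₃ i₃ ; f₁≢f₂ = f₁≢f₂ ; f₁≢f₃ = f₁≢f₃ ; f₂≢f₃ = f₂≢f₃ }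
    where
    edges-at-w : count (λ ε → incident? ε w) ≡ 3
    edges-at-w = trans (∑-cong (λ ε → indicator-∨-disjoint (eqFin w (end₁ ε)) (eqFin w (end₂ ε)) (not-both ε)))
                       (trans (sym (degree-as-∑ w)) (cubic w))
      where
      not-both : ∀ ε → eqFin w (end₁ ε) ∧ eqFin w (end₂ ε) ≡ false
      not-both ε = not-true λ h → loopless ε (trans (sym (eqFin⇒≡ w _ (∧-l h))) (eqFin⇒≡ w _ (∧-r {eqFin w (end₁ ε)} h)))
    incident?⇒Incident : ∀ ε → incident? ε w ≡ true → Incident G ε w
    incident?⇒Incident ε h with eqFin w (end₁ ε) in w₁
    ... | true = inj₁ (sym (eqFin⇒≡ _ _ w₁))
    ... | false = inj₂ (sym (eqFin⇒≡ _ _ h))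

  -- Perfect matchings through different edges at a common vertex w differ,
  -- since a perfect matching has only one edge at w.
  matchings-differ : ∀ {e f f' w} (P : PerfectMatchingThrough e f) (P' : PerfectMatchingThrough e f') →
    Incident G f w → Incident G f' w → f ≢ f' →
    PerfectMatchingThrough.matching P ≢ PerfectMatchingThrough.matching P'
  matchings-differ {f = f} {f'} {w} P P' at at' f≢f' same =
    f≢f' (trans (unique f f∈ at) (sym (unique f' (subst (f' ∈_) (sym same) (PerfectMatchingThrough.f∈ P')) at')))
    where
    open PerfectMatchingThrough P
    unique = proj₂ (proj₂ (proj₂ (perfect w)))

lemma25 : (G : Graph) → Cubic G → Bipartite G → Cyclically4EdgeConnected G →
    8 ≤ n G → (e : Edge G) →
    Σ (Subset (m G)) λ M₁ → Σ (Subset (m G)) λ M₂ → Σ (Subset (m G)) λ M₃ →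
      (M₁ ≢ M₂ × M₁ ≢ M₃ × M₂ ≢ M₃) ×
      (IsPerfectMatching G M₁ × IsPerfectMatching G M₂ × IsPerfectMatching G M₃) ×
      (e ∈ M₁ × e ∈ M₂ × e ∈ M₃)
lemma25 G cubic (colour , proper) cyc4 n≥8 e =
  matching P₁ , matching P₂ , matching P₃ ,
  (matchings-differ P₁ P₂ at₁ at₂ f₁≢f₂ , matchings-differ P₁ P₃ at₁ at₃ f₁≢f₃ , matchings-differ P₂ P₃ at₂ at₃ f₂≢f₃) ,
  (perfect P₁ , perfect P₂ , perfect P₃) ,
  (e∈ P₁ , e∈ P₂ , e∈ P₃)
  where
  open CubicBipartite G cubic colour proper cyc4
  open PerfectMatchingThrough
  open Oriented (orient e) using () renaming (left to u; right to v; joins to uv; left-true to u-true)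
  open FarFromEdge (far-vertex n≥8 uv)
  open ThreeEdgesAt (three-edges-at w)
  P₁ = through-edge-at uv u-true far-u far-v f₁ at₁
  P₂ = through-edge-at uv u-true far-u far-v f₂ at₂
  P₃ = through-edge-at uv u-true far-u far-v f₃ at₃
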